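{- For integers $n\geqslant1$ and $m\geqslant0$ let $\delta_{n,m}$ be the number of M-partitions $\lambda$ of type $(n,n,m)$ such that \[ \lambda_{=2}=\{\mathbf e_1+\mathbf e_i: i=1,\dots,n\}\subset\mathbb{N}^n \] (with $\delta_{n,0}=0$), and let $\Phi_n(t)=\sum_{m\geqslant0}\delta_{n,m}t^m$. Then \[ \Phi_n(t)=\begin{cases}\displaystyle\sum_{i\geqslant1}t^i & n=1,\\[2mm] \displaystyle\sum_{i\geqslant1}t^{i+n-2}\Big(\frac{1-t^i}{1-t}\Big)^{n-1} & n\geqslant2.\end{cases} \] Moreover, the number of headstrong M-partitions of type $(n,n,m)$ is $n\cdot\delta_{n,m}$.
   Context: Let $\mathbb{N}=\{0,1,2,\dots\}$ with $\mathbb{N}^n$ ordered componentwise, and let $\mathbf e_i$ be the $i$-th standard basis vector. A partition in $\mathbb{N}^n$ is a finite set $\lambda\subset\mathbb{N}^n$ downward closed for the componentwise order. The degree of a point is the sum of its coordinates; $\lambda_{=i}$ is the set of points of degree $i$, $h_\lambda(i)=|\lambda_{=i}|$; $\mathrm{Soc}(\lambda)$ is the set of maximal elements. For a finite $S\subset\mathbb{N}^n$, $S^\perp=\{\mathbf y:\mathbf y\leqslant\mathbf a\text{ for some }\mathbf a\in S\}$. For positive $k,q,m$, an M-partition of type $(k,q,m)$ is a partition $\lambda\subset\mathbb{N}^k$ of size $1+k+q+m$ whose socle elements all have degree $\geqslant3$, with $h_\lambda(1)=k$, $h_\lambda(2)=q$, $\sum_{i\geqslant3}h_\lambda(i)=m$.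 A headstrong composition of $M$ into $n$ parts is an $n$-tuple $(\alpha_1,\dots,\alpha_n)$ of nonnegative integers with $\sum\alpha_i=M$ and $\alpha_1\geqslant\alpha_i$ for all $i$. For $n\geqslant2$ and $m\geqslant n-1$, an M-partition $\lambda$ of type $(n,n,m)$ is headstrong if there are a headstrong composition $(\alpha_i)_{i=1}^n$ of $m-n+1$ into $n$ parts and a permutation $\sigma$ of $\{1,\dots,n\}$ with $\lambda=\big(\{(\alpha_1+2)\mathbf e_{\sigma(1)}\}\cup\{\mathbf e_{\sigma(i)}+(\alpha_i+2)\mathbf e_{\sigma(1)}: i=2,\dots,n\}\big)^\perp$; for $n=1$, every M-partition of type $(1,1,m)$ is regarded as headstrong. -}

module Defs where

open import Data.Nat using (ℕ; zero; suc; _+_; _*_; _∸_; _≤_; _<_; _≟_; _≤?_)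
open import Data.Fin using (Fin)
import Data.Fin as F
open import Data.Vec as V using (Vec; lookup; zipWith; replicate; _[_]≔_)
open import Data.List as L using (List; []; _∷_; length; filter; upTo; allFin; _++_)
open import Data.List.Membership.Propositional using (_∈_)
open import Data.List.Relation.Unary.Any using (Any)
open import Data.List.Relation.Unary.Unique.Propositional using (Unique)
open import Data.Fin.Permutation using (Permutation′; _⟨$⟩ʳ_)
open import Data.Product using (Σ; _×_; ∃; ∃-syntax)
open import Data.Unit using (⊤)
open import Relation.Binary.PropositionalEquality using (_≡_)

Point : ℕ → Set
Point n = Vec ℕ n

_≤ᵥ_ : ∀ {n} → Point n → Point n → Set
x ≤ᵥ y = ∀ i → lookup x i ≤ lookup y i

deg : ∀ {n} → Point n → ℕ
deg = V.sum

e : ∀ {n} → Fin n → Point n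
e {n} i = replicate n 0 [ i ]≔ 1

_+ᵥ_ : ∀ {n} → Point n → Point n → Point n
_+ᵥ_ = zipWith _+_

_·ᵥ_ : ∀ {n} → ℕ → Point n → Point n
k ·ᵥ x = V.map (k *_) x

-- Finite subsets of ℕ^n are represented by duplicate-free lists;
-- two lists represent the same set iff they have the same members.

_≋_ : ∀ {n} → List (Point n) → List (Point n) → Set
l ≋ l' = ∀ x → (x ∈ l → x ∈ l') × (x ∈ l' → x ∈ l)

h : ∀ {n} → List (Point n) → ℕ → ℕ
h λs i = length (filter (λ x → deg x ≟ i) λs)

h≥3 : ∀ {n} → List (Point n) → ℕ
h≥3 λs = length (filter (λ x → 3 ≤? deg x) λs)

IsMaximal : ∀ {n} → List (Point n) → Point n → Set
IsMaximal λs x = ∀ y → y ∈ λs → x ≤ᵥ y → y ≡ x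

IsPartition : ∀ {n} → List (Point n) → Set
IsPartition λs = Unique λs × (∀ x → x ∈ λs → ∀ y → y ≤ᵥ x → y ∈ λs)

MPartition : (k q m : ℕ) → List (Point k) → Set
MPartition k q m λs =
  (1 ≤ k) × (1 ≤ q) × (1 ≤ m) ×
  IsPartition λs ×
  (length λs ≡ 1 + k + q + m) ×
  (∀ x → x ∈ λs → IsMaximal λs x → 3 ≤ deg x) ×
  (h λs 1 ≡ k) × (h λs 2 ≡ q) × (h≥3 λs ≡ m)

deg2Target : (k : ℕ) → List (Point (suc k))
deg2Target k = L.map (λ i → e F.zero +ᵥ e i) (allFin (suc k))

Deg2Standard : (k : ℕ) → List (Point (suc k)) → Set
Deg2Standard k λs =
  ∀ x → ((x ∈ λs × deg x ≡ 2) → x ∈ deg2Target k)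
      × (x ∈ deg2Target k → (x ∈ λs × deg x ≡ 2))

DeltaSet : (k m : ℕ) → List (Point (suc k)) → Set
DeltaSet k m λs = MPartition (suc k) (suc k) m λs × Deg2Standard k λs

headSet : (j : ℕ) → Vec ℕ (suc (suc j)) → Permutation′ (suc (suc j))
        → List (Point (suc (suc j)))
headSet j α σ =
  ((lookup α F.zero + 2) ·ᵥ e (σ ⟨$⟩ʳ F.zero))
  ∷ L.map (λ i → e (σ ⟨$⟩ʳ F.suc i)
                   +ᵥ ((lookup α (F.suc i) + 2) ·ᵥ e (σ ⟨$⟩ʳ F.zero)))
          (allFin (suc j))

Headstrong : (k m : ℕ) → List (Point (suc k)) → Set
Headstrong zero m λs = ⊤
Headstrong (suc j) m λs =
  (suc j ≤ m) ×
  Σ (Vec ℕ (suc (suc j))) λ α →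
    (V.sum α ≡ m ∸ suc j) ×
    (∀ i → lookup α i ≤ lookup α F.zero) ×
    Σ (Permutation′ (suc (suc j))) λ σ →
      ∀ y → (y ∈ λs → ∃[ a ] (a ∈ headSet j α σ × y ≤ᵥ a))
          × (∃[ a ] (a ∈ headSet j α σ × y ≤ᵥ a) → y ∈ λs)

record HasCount {A : Set} (_≈_ : A → A → Set) (P : A → Set) (c : ℕ) : Set where
  field
    elems    : Vec A c
    sound    : ∀ i → P (lookup elems i)
    distinct : ∀ i j → lookup elems i ≈ lookup elems j → i ≡ j
    complete : ∀ a → P a → ∃[ i ] (a ≈ lookup elems i)

-- Polynomials with ℕ coefficients (coefficient lists, constant first)

Poly : Set
Poly = List ℕ

_⊕_ : Poly → Poly → Poly
[] ⊕ q = q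
(a ∷ p) ⊕ [] = a ∷ p
(a ∷ p) ⊕ (b ∷ q) = (a + b) ∷ (p ⊕ q)

_⊛_ : Poly → Poly → Poly
[] ⊛ q = []
(a ∷ p) ⊛ q = L.map (a *_) q ⊕ (0 ∷ (p ⊛ q))

_^ₚ_ : Poly → ℕ → Poly
p ^ₚ zero = 1 ∷ []
p ^ₚ suc r = p ⊛ (p ^ₚ r)

shift : ℕ → Poly → Poly
shift s p = L.replicate s 0 ++ p

coeff : Poly → ℕ → ℕ
coeff [] _ = 0
coeff (a ∷ p) zero = a
coeff (a ∷ p) (suc r) = coeff p r

-- (1 - t^i)/(1 - t) = 1 + t + ... + t^{i-1}
geom : ℕ → Poly
geom i = L.replicate i 1

polySum : List Poly → Poly
polySum = L.foldr _⊕_ []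

-- [t^m] Φ_n(t), n = suc k.
-- n = 1 : Φ₁ = Σ_{i≥1} t^i.
-- n = j+2 : Φ_n = Σ_{i≥1} t^{i+n-2} ((1-t^i)/(1-t))^{n-1}; only terms with
--   i ≤ m+1 can contribute to t^m (the i-th term is divisible by t^{i+n-2}).
coeffΦ : (k m : ℕ) → ℕ
coeffΦ zero zero = 0
coeffΦ zero (suc m) = 1
coeffΦ (suc j) m =
  coeff (polySum (L.map (λ i → shift (i + j) (geom i ^ₚ suc j))
                        (L.map suc (upTo (suc m)))))
        m

-- In a δ-partition every point lies on the spine ℕe₁ or on a tooth ℕe₁ + e_t
-- (t ≥ 2): a point whose last n − 1 coordinates sum to ≥ 2 lies above a
-- degree-2 point with first coordinate 0, and no such point is of the form
-- e₁ + e_i.  So the partition is a comb, determined by the spine top (i + 1)e₁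
-- and the tooth tops (c_t + 2)e₁ + e_t; downward closure and the socle
-- condition say exactly i ≥ 1 and c_t < i, and the size condition says
-- i + (n − 1) + Σ c = m + 1.  For fixed i, the tooth parameters c_t ∈ [0, i)
-- are counted by ((1 − t^i)/(1 − t))^(n−1), which gives the coefficient of
-- t^m in Φ_n.  A headstrong partition is such a comb with its spine moved to
-- one of the n coordinates (α₁ = i − 1, α_t = c_t), and the spine position is
-- the unique coordinate reaching 2; hence the factor n.
module Submission where

open import Data.Empty using (⊥-elim)
open import Data.Fin as F using (Fin; _↑ˡ_; _↑ʳ_; splitAt; punchIn; punchOut)
import Data.Fin.Properties as FP
open import Data.Fin.Permutation
  using (Permutation′; _⟨$⟩ʳ_; _⟨$⟩ˡ_; inverseˡ; inverseʳ; insert; id)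
open import Data.List as L using (List; []; _∷_; length; filter; upTo; allFin)
open import Data.List.Membership.Propositional using (_∈_)
open import Data.List.Membership.Propositional.Properties
import Data.List.Properties as LP
import Data.List.Relation.Unary.All as All
import Data.List.Relation.Unary.AllPairs as AP
open import Data.List.Relation.Unary.Any using (here; there)
open import Data.List.Relation.Unary.Unique.Propositional using (Unique)
import Data.List.Relation.Unary.Unique.Propositional.Properties as UP
open import Data.Nat using (ℕ; zero; suc; _+_; _*_; _∸_; _≤_; _<_; z≤n; s≤s; _≤?_)
open import Data.Nat.Properties
open import Algebra.Properties.CommutativeSemigroup +-commutativeSemigroup using (x∙yz≈y∙xz)
open import Data.List.Extrema ≤-totalOrder
  using (argmax; argmax-all; f[⊥]≤f[argmax]; f[xs]≤f[argmax])
open import Data.Nat.Tactic.RingSolver using (solve-∀)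
open import Data.Product using (_×_; _,_; Σ; ∃; ∃-syntax; proj₁; proj₂; swap)
open import Data.Sum using (_⊎_; inj₁; inj₂)
open import Data.Unit using (tt)
open import Data.Vec as V using (Vec; []; _∷_; lookup; replicate; tabulate; insertAt; removeAt)
import Data.Vec.Properties as VP
open import Function using (_∘′_)
open import Relation.Nullary using (¬_; yes; no; Dec)
open import Relation.Binary.PropositionalEquality

open import Defs

open HasCount

module _ {A : Set} {_≈_ : A → A → Set} where

  count-∅ : {P : A → Set} → (∀ a → ¬ P a) → HasCount _≈_ P 0
  count-∅ ¬P = record
    { elems = [] ; sound = λ () ; distinct = λ () ; complete = λ a p → ⊥-elim (¬P a p) }

  count-singleton : {P : A → Set} (x : A) → P x → (∀ a → P a → a ≈ x) → HasCount _≈_ P 1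
  count-singleton x px unique = record
    { elems    = x ∷ []
    ; sound    = λ { F.zero → px }
    ; distinct = λ { F.zero F.zero _ → refl }
    ; complete = λ a pa → F.zero , unique a pa
    }

  count-⇔ : {P Q : A → Set} {c : ℕ} →
            (∀ a → P a → Q a) → (∀ a → Q a → P a) → HasCount _≈_ P c → HasCount _≈_ Q c
  count-⇔ P⇒Q Q⇒P H = record
    { elems    = elems H
    ; sound    = λ i → P⇒Q _ (sound H i)
    ; distinct = distinct H
    ; complete = λ a qa → complete H a (Q⇒P a qa)
    }

↑-view : ∀ a b (i : Fin (a + b)) → (∃[ i' ] i ≡ i' ↑ˡ b) ⊎ (∃[ i' ] i ≡ a ↑ʳ i')
↑-view a b i with splitAt a i in eq
... | inj₁ x = inj₁ (x , sym (FP.splitAt⁻¹-↑ˡ eq))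
... | inj₂ y = inj₂ (y , sym (FP.splitAt⁻¹-↑ʳ eq))

count-⊎ : {A : Set} {P Q : A → Set} {a b : ℕ} →
          HasCount _≡_ P a → HasCount _≡_ Q b → (∀ x → P x → ¬ Q x) →
          HasCount _≡_ (λ x → P x ⊎ Q x) (a + b)
count-⊎ {A} {P} {Q} {a} {b} H K disjoint = record
  { elems = xs ; sound = sound′ ; distinct = distinct′ ; complete = complete′ }
  where
  xs : Vec A (a + b)
  xs = elems H V.++ elems K
  left : ∀ i → lookup xs (i ↑ˡ b) ≡ lookup (elems H) i
  left = VP.lookup-++ˡ (elems H) (elems K)
  right : ∀ i → lookup xs (a ↑ʳ i) ≡ lookup (elems K) i
  right = VP.lookup-++ʳ (elems H) (elems K)
  sound′ : ∀ i → P (lookup xs i) ⊎ Q (lookup xs i)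
  sound′ i with ↑-view a b i
  ... | inj₁ (i' , refl) = inj₁ (subst P (sym (left i')) (sound H i'))
  ... | inj₂ (i' , refl) = inj₂ (subst Q (sym (right i')) (sound K i'))
  distinct′ : ∀ i j → lookup xs i ≡ lookup xs j → i ≡ j
  distinct′ i j eq with ↑-view a b i | ↑-view a b j
  ... | inj₁ (i' , refl) | inj₁ (j' , refl) =
    cong (_↑ˡ b) (distinct H i' j' (trans (sym (left i')) (trans eq (left j'))))
  ... | inj₁ (i' , refl) | inj₂ (j' , refl) = ⊥-elim (disjoint _ (sound H i')
    (subst Q (trans (sym (right j')) (trans (sym eq) (left i'))) (sound K j')))
  ... | inj₂ (i' , refl) | inj₁ (j' , refl) = ⊥-elim (disjoint _ (sound H j')
    (subst Q (trans (sym (right i')) (trans eq (left j'))) (sound K i')))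
  ... | inj₂ (i' , refl) | inj₂ (j' , refl) =
    cong (a ↑ʳ_) (distinct K i' j' (trans (sym (right i')) (trans eq (right j'))))
  complete′ : ∀ x → P x ⊎ Q x → ∃[ i ] (x ≡ lookup xs i)
  complete′ x (inj₁ px) with complete H x px
  ... | i , x≡ = i ↑ˡ b , trans x≡ (sym (left i))
  complete′ x (inj₂ qx) with complete K x qx
  ... | i , x≡ = a ↑ʳ i , trans x≡ (sym (right i))

count-image : {A B : Set} {P : A → Set} {Q : B → Set} {_≈_ : B → B → Set} {c : ℕ} →
              HasCount _≡_ P c → (f : A → B) → (∀ a → P a → Q (f a)) →
              (∀ a a' → P a → P a' → f a ≈ f a' → a ≡ a') →
              (∀ b → Q b → Σ A λ a → P a × b ≈ f a) →
              HasCount _≈_ Q c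
count-image {Q = Q} {_≈_} H f f-sound f-inj f-onto = record
  { elems    = V.map f (elems H)
  ; sound    = λ i → subst Q (sym (lookup-f i)) (f-sound _ (sound H i))
  ; distinct = λ i j r → distinct H i j
      (f-inj _ _ (sound H i) (sound H j) (subst₂ _≈_ (lookup-f i) (lookup-f j) r))
  ; complete = λ b qb →
      let (a , pa , b≈fa) = f-onto b qb
          (i , a≡)        = complete H a pa
      in i , subst (b ≈_) (trans (cong f a≡) (sym (lookup-f i))) b≈fa
  }
  where
  lookup-f : ∀ i → lookup (V.map f (elems H)) i ≡ f (lookup (elems H) i)
  lookup-f i = VP.lookup-map i f (elems H)

count-Fin× : {X : Set} {Q : X → Set} {c : ℕ} → HasCount _≡_ Q c →
             ∀ n → HasCount _≡_ (λ (p : Fin n × X) → Q (proj₂ p)) (n * c)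
count-Fin× H zero = count-∅ λ { (() , _) _ }
count-Fin× {X} {Q} H (suc n) = count-⇔ merge split (count-⊎ at-zero at-suc disjoint)
  where
  AtZero AtSuc : Fin (suc n) × X → Set
  AtZero (p , x) = p ≡ F.zero × Q x
  AtSuc  (p , x) = (∃[ p' ] p ≡ F.suc p') × Q x
  at-zero : HasCount _≡_ AtZero _
  at-zero = count-image H (F.zero ,_) (λ _ q → refl , q) (λ { _ _ _ _ refl → refl })
    (λ { (_ , x) (refl , q) → x , q , refl })
  at-suc : HasCount _≡_ AtSuc _
  at-suc = count-image (count-Fin× H n) (λ (p , x) → F.suc p , x) (λ (p , _) q → (p , refl) , q)
    (λ { _ _ _ _ refl → refl }) (λ { (_ , x) ((p , refl) , q) → (p , x) , q , refl })
  disjoint : ∀ a → AtZero a → ¬ AtSuc a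
  disjoint _ (refl , _) ((_ , ()) , _)
  merge : ∀ a → AtZero a ⊎ AtSuc a → Q (proj₂ a)
  merge _ (inj₁ (_ , q)) = q
  merge _ (inj₂ (_ , q)) = q
  split : ∀ a → Q (proj₂ a) → AtZero a ⊎ AtSuc a
  split (F.zero  , _) q = inj₁ (refl , q)
  split (F.suc p , _) q = inj₂ ((p , refl) , q)

coeff-⊕ : ∀ p q s → coeff (p ⊕ q) s ≡ coeff p s + coeff q s
coeff-⊕ []      q       s       = refl
coeff-⊕ (a ∷ p) []      s       = sym (+-identityʳ _)
coeff-⊕ (a ∷ p) (b ∷ q) zero    = refl
coeff-⊕ (a ∷ p) (b ∷ q) (suc s) = coeff-⊕ p q s

coeff-1* : ∀ q s → coeff (L.map (1 *_) q) s ≡ coeff q s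
coeff-1* []      s       = refl
coeff-1* (a ∷ q) zero    = +-identityʳ a
coeff-1* (a ∷ q) (suc s) = coeff-1* q s

coeff-shift-≥ : ∀ t p {s} → t ≤ s → coeff (shift t p) s ≡ coeff p (s ∸ t)
coeff-shift-≥ zero    p _         = refl
coeff-shift-≥ (suc t) p (s≤s t≤s) = coeff-shift-≥ t p t≤s

coeff-shift-< : ∀ t p {s} → s < t → coeff (shift t p) s ≡ 0
coeff-shift-< (suc t) p {zero}  _         = refl
coeff-shift-< (suc t) p {suc s} (s≤s s<t) = coeff-shift-< t p s<t

coeff-geom⊛ : ∀ i q s → coeff (geom (suc i) ⊛ q) s ≡ coeff q s + coeff (0 ∷ (geom i ⊛ q)) s
coeff-geom⊛ i q s = begin
  coeff (L.map (1 *_) q ⊕ (0 ∷ (geom i ⊛ q))) s          ≡⟨ coeff-⊕ (L.map (1 *_) q) _ s ⟩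
  coeff (L.map (1 *_) q) s + coeff (0 ∷ (geom i ⊛ q)) s  ≡⟨ cong (_+ rest) (coeff-1* q s) ⟩
  coeff q s + coeff (0 ∷ (geom i ⊛ q)) s                 ∎
  where
  open ≡-Reasoning
  rest : ℕ
  rest = coeff (0 ∷ (geom i ⊛ q)) s

HeadBelow : ∀ {r} → ℕ → (ℕ → Vec ℕ r → Set) → ℕ → Vec ℕ (suc r) → Set
HeadBelow i Q s (t ∷ w) = t < i × t ≤ s × Q (s ∸ t) w

-- Multiplying by 1 + t + ⋯ + t^(i-1) prepends an entry below i.
count-geom⊛ : ∀ {r} {Q : ℕ → Vec ℕ r → Set} q → (∀ s → HasCount _≡_ (Q s) (coeff q s)) →
              ∀ i s → HasCount _≡_ (HeadBelow i Q s) (coeff (geom i ⊛ q) s)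
count-geom⊛ q count-Q zero s = count-∅ λ { (_ ∷ _) (() , _) }
count-geom⊛ {r} {Q} q count-Q (suc i) s =
  subst (HasCount _≡_ _) (sym (coeff-geom⊛ i q s))
    (count-⇔ merge split (count-⊎ head-zero (head-suc s) disjoint))
  where
  HeadZero : Vec ℕ (suc r) → Set
  HeadZero (t ∷ w) = t ≡ 0 × Q s w
  HeadSuc : ℕ → Vec ℕ (suc r) → Set
  HeadSuc s (t ∷ w) = ∃[ t' ] t ≡ suc t' × ∃[ s' ] s ≡ suc s' × HeadBelow i Q s' (t' ∷ w)
  head-zero : HasCount _≡_ HeadZero (coeff q s)
  head-zero = count-image (count-Q s) (0 ∷_) (λ _ q → refl , q) (λ _ _ _ _ → VP.∷-injectiveʳ)
    (λ { (_ ∷ w) (refl , q) → w , q , refl })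
  head-suc : ∀ s → HasCount _≡_ (HeadSuc s) (coeff (0 ∷ (geom i ⊛ q)) s)
  head-suc zero    = count-∅ λ { (_ ∷ _) (_ , _ , _ , () , _) }
  head-suc (suc s) = count-image (count-geom⊛ q count-Q i s) (λ { (t ∷ w) → suc t ∷ w })
    (λ { (t ∷ _) h → t , refl , s , refl , h }) (λ { (_ ∷ _) (_ ∷ _) _ _ refl → refl })
    (λ { (_ ∷ w) (t , refl , _ , refl , h) → t ∷ w , h , refl })
  disjoint : ∀ v → HeadZero v → ¬ HeadSuc s v
  disjoint (_ ∷ _) (refl , _) (_ , () , _)
  merge : ∀ v → HeadZero v ⊎ HeadSuc s v → HeadBelow (suc i) Q s v
  merge (_ ∷ _) (inj₁ (refl , q))                          = s≤s z≤n , z≤n , q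
  merge (_ ∷ _) (inj₂ (_ , refl , _ , refl , t<i , t≤s , q)) = s≤s t<i , s≤s t≤s , q
  split : ∀ v → HeadBelow (suc i) Q s v → HeadZero v ⊎ HeadSuc s v
  split (zero  ∷ _) (_ , _ , q)                   = inj₁ (refl , q)
  split (suc t ∷ _) (s≤s t<i , s≤s {n = s'} t≤s , q) = inj₂ (t , refl , s' , refl , t<i , t≤s , q)

Composition< : ℕ → {r : ℕ} → ℕ → Vec ℕ r → Set
Composition< i s v = (∀ t → lookup v t < i) × V.sum v ≡ s

composition<-∷⁺ : ∀ {i r s} (v : Vec ℕ (suc r)) →
                  HeadBelow i (Composition< i) s v → Composition< i s v
composition<-∷⁺ (x ∷ w) (x<i , x≤s , w< , Σw) =
  (λ { F.zero → x<i ; (F.suc t) → w< t }) , trans (cong (x +_) Σw) (m+[n∸m]≡n x≤s)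

composition<-∷⁻ : ∀ {i r s} (v : Vec ℕ (suc r)) →
                  Composition< i s v → HeadBelow i (Composition< i) s v
composition<-∷⁻ (x ∷ w) (v< , refl) =
  v< F.zero , m≤m+n x (V.sum w) , (λ t → v< (F.suc t)) , sym (m+n∸m≡n x (V.sum w))

count-composition< : ∀ i r s → HasCount _≡_ (Composition< i {r} s) (coeff (geom i ^ₚ r) s)
count-composition< i zero zero    = count-singleton [] ((λ ()) , refl) (λ { [] _ → refl })
count-composition< i zero (suc s) = count-∅ λ { [] (_ , ()) }
count-composition< i (suc r) s =
  count-⇔ composition<-∷⁺ composition<-∷⁻
    (count-geom⊛ (geom i ^ₚ r) (count-composition< i r) i s)

count-polySum : ∀ {X : Set} {T : ℕ → X → Set} (f : ℕ → Poly) m →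
                (∀ i → HasCount _≡_ (T i) (coeff (f i) m)) →
                ∀ l → Unique l →
                HasCount _≡_ (λ (p : ℕ × X) → proj₁ p ∈ l × T (proj₁ p) (proj₂ p))
                         (coeff (polySum (L.map f l)) m)
count-polySum f m count-T []      _           = count-∅ λ { _ (() , _) }
count-polySum {X} {T} f m count-T (x ∷ l) (x∉l AP.∷ l!) =
  subst (HasCount _≡_ _) (sym (coeff-⊕ (f x) (polySum (L.map f l)) m))
    (count-⇔ merge split (count-⊎ at-x (count-polySum f m count-T l l!) disjoint))
  where
  AtX : ℕ × X → Set
  AtX (i , y) = i ≡ x × T i y
  at-x : HasCount _≡_ AtX (coeff (f x) m)
  at-x = count-image (count-T x) (x ,_) (λ _ t → refl , t) (λ { _ _ _ _ refl → refl })
    (λ { (_ , y) (refl , t) → y , t , refl })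
  disjoint : ∀ p → AtX p → ¬ (proj₁ p ∈ l × T (proj₁ p) (proj₂ p))
  disjoint _ (refl , _) (x∈l , _) = All.lookup x∉l x∈l refl
  merge : ∀ p → AtX p ⊎ (proj₁ p ∈ l × T (proj₁ p) (proj₂ p)) →
          proj₁ p ∈ x ∷ l × T (proj₁ p) (proj₂ p)
  merge _ (inj₁ (refl , t)) = here refl , t
  merge _ (inj₂ (i∈l , t))  = there i∈l , t
  split : ∀ p → proj₁ p ∈ x ∷ l × T (proj₁ p) (proj₂ p) →
          AtX p ⊎ (proj₁ p ∈ l × T (proj₁ p) (proj₂ p))
  split _ (here refl , t) = inj₁ (refl , t)
  split _ (there i∈l , t) = inj₂ (i∈l , t)

-- The comb with spine top (i + 1)e₁ and tooth tops (c_t + 2)e₁ + e_{t+2} for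
-- t = 0, …, k − 1; in the paper's notation α₁ = i − 1 and α_{t+2} = c_t.
Shape : (k m : ℕ) → ℕ × Vec ℕ k → Set
Shape k m (i , c) = 1 ≤ i × (∀ t → lookup c t < i) × suc m ≡ i + k + V.sum c

+-suc-middle : ∀ i j s → i + suc j + s ≡ suc (i + j + s)
+-suc-middle i j s = cong (_+ s) (+-suc i j)

count-shape : ∀ j m → HasCount _≡_ (Shape (suc j) m) (coeffΦ (suc j) m)
count-shape j m =
  count-⇔ term⇒shape shape⇒term
    (count-polySum term m count-term _ (UP.map⁺ suc-injective (UP.upTo⁺ (suc m))))
  where
  term : ℕ → Poly
  term i = shift (i + j) (geom i ^ₚ suc j)
  Term : ℕ → Vec ℕ (suc j) → Set
  Term i c = i + j ≤ m × Composition< i (m ∸ (i + j)) c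
  count-term : ∀ i → HasCount _≡_ (Term i) (coeff (term i) m)
  count-term i with i + j ≤? m
  ... | yes i+j≤m = subst (HasCount _≡_ _) (sym (coeff-shift-≥ (i + j) _ i+j≤m))
    (count-⇔ (λ _ → i+j≤m ,_) (λ _ → proj₂) (count-composition< i (suc j) (m ∸ (i + j))))
  ... | no  i+j≰m = subst (HasCount _≡_ _) (sym (coeff-shift-< (i + j) _ (≰⇒> i+j≰m)))
    (count-∅ λ _ → i+j≰m ∘′ proj₁)
  InTerm : ℕ × Vec ℕ (suc j) → Set
  InTerm (i , c) = i ∈ L.map suc (upTo (suc m)) × Term i c
  term⇒shape : ∀ p → InTerm p → Shape (suc j) m p
  term⇒shape (i , c) (i∈ , i+j≤m , c< , Σc) with ∈-map⁻ suc i∈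
  ... | _ , _ , refl = s≤s z≤n , c< , trans
    (cong suc (trans (sym (m+[n∸m]≡n i+j≤m)) (cong (i + j +_) (sym Σc)))) (sym (+-suc-middle i j _))
  shape⇒term : ∀ p → Shape (suc j) m p → InTerm p
  shape⇒term (suc x , c) (_ , c< , size) =
    ∈-map⁺ suc (∈-upTo⁺ (s≤s x≤m)) , i+j≤m , c< ,
    sym (trans (cong (_∸ (suc x + j)) m≡) (m+n∸m≡n (suc x + j) (V.sum c)))
    where
    m≡ : m ≡ suc x + j + V.sum c
    m≡ = suc-injective (trans size (+-suc-middle (suc x) j _))
    i+j≤m : suc x + j ≤ m
    i+j≤m = subst (suc x + j ≤_) (sym m≡) (m≤m+n _ _)
    x≤m : x ≤ m
    x≤m = ≤-trans (n≤1+n x) (≤-trans (m≤m+n (suc x) j) i+j≤m)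

0ᵥ : ∀ {k} → Point k
0ᵥ {k} = replicate k 0

sum-0ᵥ : ∀ k → V.sum (0ᵥ {k}) ≡ 0
sum-0ᵥ zero    = refl
sum-0ᵥ (suc k) = sum-0ᵥ k

deg-e : ∀ {k} (t : Fin k) → deg (e t) ≡ 1
deg-e {suc k} F.zero    = cong suc (sum-0ᵥ k)
deg-e         (F.suc t) = deg-e t

deg-spine : ∀ k a → deg (a ∷ 0ᵥ {k}) ≡ a
deg-spine k a = trans (cong (a +_) (sum-0ᵥ k)) (+-identityʳ a)

deg-tooth : ∀ {k} a (t : Fin k) → deg (a ∷ e t) ≡ suc a
deg-tooth a t = trans (cong (a +_) (deg-e t)) (+-comm a 1)

≤ᵥ-refl : ∀ {k} {v : Point k} → v ≤ᵥ v
≤ᵥ-refl _ = ≤-refl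

≤ᵥ-reflexive : ∀ {k} {u v : Point k} → u ≡ v → u ≤ᵥ v
≤ᵥ-reflexive refl _ = ≤-refl

≤ᵥ-∷ : ∀ {k a b} {v w : Point k} → a ≤ b → v ≤ᵥ w → (a ∷ v) ≤ᵥ (b ∷ w)
≤ᵥ-∷ a≤b v≤w F.zero    = a≤b
≤ᵥ-∷ a≤b v≤w (F.suc i) = v≤w i

≤ᵥ-tail : ∀ {k a b} {v w : Point k} → (a ∷ v) ≤ᵥ (b ∷ w) → v ≤ᵥ w
≤ᵥ-tail le i = le (F.suc i)

0ᵥ≤ᵥ : ∀ {k} (v : Point k) → 0ᵥ ≤ᵥ v
0ᵥ≤ᵥ {k} v i = subst (_≤ lookup v i) (sym (VP.lookup-replicate i 0)) z≤n

≤ᵥ0ᵥ : ∀ {k} (v : Point k) → v ≤ᵥ 0ᵥ → v ≡ 0ᵥ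
≤ᵥ0ᵥ []      le = refl
≤ᵥ0ᵥ (x ∷ v) le = cong₂ _∷_ (n≤0⇒n≡0 (le F.zero)) (≤ᵥ0ᵥ v (≤ᵥ-tail le))

e≢0ᵥ : ∀ {k} (t : Fin k) → e t ≢ 0ᵥ
e≢0ᵥ {k} t eq = 1+n≢0 (trans (sym (deg-e t)) (trans (cong deg eq) (sum-0ᵥ k)))

≤ᵥe : ∀ {k} (v : Point k) t → v ≤ᵥ e t → v ≡ 0ᵥ ⊎ v ≡ e t
≤ᵥe (x ∷ v) F.zero le with ≤ᵥ0ᵥ v (≤ᵥ-tail le) | le F.zero
... | refl | z≤n     = inj₁ refl
... | refl | s≤s z≤n = inj₂ refl
≤ᵥe (x ∷ v) (F.suc t) le with n≤0⇒n≡0 (le F.zero) | ≤ᵥe v t (≤ᵥ-tail le)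
... | refl | inj₁ refl = inj₁ refl
... | refl | inj₂ refl = inj₂ refl

e≤ᵥe⇒≡ : ∀ {k} (t t' : Fin k) → e t ≤ᵥ e t' → t ≡ t'
e≤ᵥe⇒≡ F.zero    F.zero     le = refl
e≤ᵥe⇒≡ F.zero    (F.suc t') le with le F.zero
... | ()
e≤ᵥe⇒≡ (F.suc t) F.zero     le = ⊥-elim (e≢0ᵥ t (≤ᵥ0ᵥ (e t) (≤ᵥ-tail le)))
e≤ᵥe⇒≡ (F.suc t) (F.suc t') le = cong F.suc (e≤ᵥe⇒≡ t t' (≤ᵥ-tail le))

e-injective : ∀ {k} {t t' : Fin k} → e t ≡ e t' → t ≡ t'
e-injective {t = t} {t'} eq = e≤ᵥe⇒≡ t t' (≤ᵥ-reflexive eq)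

lookup-e-≡ : ∀ {k} (t : Fin k) → lookup (e t) t ≡ 1
lookup-e-≡ {k} t = VP.lookup∘update t (replicate k 0) 1

lookup-e-≢ : ∀ {k} (t q : Fin k) → q ≢ t → lookup (e t) q ≡ 0
lookup-e-≢ {k} t q q≢t = trans (VP.lookup∘update′ q≢t (replicate k 0) 1) (VP.lookup-replicate q 0)

lookup-e≤1 : ∀ {k} (t q : Fin k) → lookup (e t) q ≤ 1
lookup-e≤1 t q with q FP.≟ t
... | yes refl = ≤-reflexive (lookup-e-≡ t)
... | no  q≢t  = subst (_≤ 1) (sym (lookup-e-≢ t q q≢t)) z≤n

lookup-extensional : ∀ {k} {u v : Point k} → (∀ t → lookup u t ≡ lookup v t) → u ≡ v
lookup-extensional {u = u} {v} eq =
  trans (sym (VP.tabulate∘lookup u)) (trans (VP.tabulate-cong eq) (VP.tabulate∘lookup v))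

0ᵥ+ᵥ : ∀ {k} (v : Point k) → 0ᵥ +ᵥ v ≡ v
0ᵥ+ᵥ []      = refl
0ᵥ+ᵥ (x ∷ v) = cong (x ∷_) (0ᵥ+ᵥ v)

+ᵥ0ᵥ : ∀ {k} (v : Point k) → v +ᵥ 0ᵥ ≡ v
+ᵥ0ᵥ []      = refl
+ᵥ0ᵥ (x ∷ v) = cong₂ _∷_ (+-identityʳ x) (+ᵥ0ᵥ v)

e₀+ᵥe₀ : ∀ {k} → e {suc k} F.zero +ᵥ e F.zero ≡ 2 ∷ 0ᵥ
e₀+ᵥe₀ = cong (2 ∷_) (0ᵥ+ᵥ 0ᵥ)

e₀+ᵥe-suc : ∀ {k} (t : Fin k) → e {suc k} F.zero +ᵥ e (F.suc t) ≡ 1 ∷ e t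
e₀+ᵥe-suc t = cong (1 ∷_) (0ᵥ+ᵥ (e t))

+ᵥ-cancelˡ : ∀ {k} (u v w : Point k) → u +ᵥ v ≡ u +ᵥ w → v ≡ w
+ᵥ-cancelˡ []      []      []      _  = refl
+ᵥ-cancelˡ (a ∷ u) (b ∷ v) (c ∷ w) eq =
  cong₂ _∷_ (+-cancelˡ-≡ a b c (VP.∷-injectiveˡ eq)) (+ᵥ-cancelˡ u v w (VP.∷-injectiveʳ eq))

deg≡0⇒0ᵥ : ∀ {k} (v : Point k) → deg v ≡ 0 → v ≡ 0ᵥ
deg≡0⇒0ᵥ []           _     = refl
deg≡0⇒0ᵥ (zero ∷ v)   deg≡0 = cong (0 ∷_) (deg≡0⇒0ᵥ v deg≡0)

deg≤1⇒0ᵥ⊎e : ∀ {k} (v : Point k) → deg v ≤ 1 → v ≡ 0ᵥ ⊎ ∃[ t ] v ≡ e t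
deg≤1⇒0ᵥ⊎e []                _       = inj₁ refl
deg≤1⇒0ᵥ⊎e (zero ∷ v)        deg≤1   with deg≤1⇒0ᵥ⊎e v deg≤1
... | inj₁ refl       = inj₁ refl
... | inj₂ (t , refl) = inj₂ (F.suc t , refl)
deg≤1⇒0ᵥ⊎e (suc zero ∷ v)    (s≤s deg≤0) with deg≡0⇒0ᵥ v (n≤0⇒n≡0 deg≤0)
... | refl = inj₂ (F.zero , refl)
deg≤1⇒0ᵥ⊎e (suc (suc _) ∷ _) (s≤s ())

below-of-degree : ∀ {k} d (v : Point k) → d ≤ deg v → ∃[ w ] w ≤ᵥ v × deg w ≡ d
below-of-degree d []      d≤0 = [] , (λ ()) , sym (n≤0⇒n≡0 d≤0)
below-of-degree {suc k} d (x ∷ v) d≤  with d ≤? x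
... | yes d≤x = d ∷ 0ᵥ , ≤ᵥ-∷ d≤x (0ᵥ≤ᵥ v) , deg-spine k d
... | no  d≰x with below-of-degree (d ∸ x) v
                     (subst (d ∸ x ≤_) (m+n∸m≡n x (deg v)) (∸-monoˡ-≤ x d≤))
... | w , w≤v , deg-w = x ∷ w , ≤ᵥ-∷ ≤-refl w≤v ,
                        trans (cong (x +_) deg-w) (m+[n∸m]≡n (<⇒≤ (≰⇒> d≰x)))

unique-length-≤ : ∀ {X : Set} (l l' : List X) → Unique l → (∀ x → x ∈ l → x ∈ l') →
                  length l ≤ length l'
unique-length-≤ []      l' _            _   = z≤n
unique-length-≤ (x ∷ l) l' (x∉l AP.∷ l!) l⊆l' with ∈-∃++ (l⊆l' x (here refl))
... | ys , zs , refl = subst (suc (length l) ≤_) (sym (LP.length-++-sucʳ ys x zs))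
  (s≤s (unique-length-≤ l (ys L.++ zs) l! λ y y∈l → ∈-without ys (l⊆l' y (there y∈l))
    λ y≡x → All.lookup x∉l y∈l (sym y≡x)))
  where
  ∈-without : ∀ {X : Set} (ys : List X) {zs : List X} {x y : X} →
              y ∈ ys L.++ x ∷ zs → y ≢ x → y ∈ ys L.++ zs
  ∈-without []       (here y≡x) y≢x = ⊥-elim (y≢x y≡x)
  ∈-without []       (there y∈) _   = y∈
  ∈-without (_ ∷ ys) (here y≡)  _   = here y≡
  ∈-without (_ ∷ ys) (there y∈) y≢x = there (∈-without ys y∈ y≢x)

unique-length-≡ : ∀ {X : Set} {l l' : List X} → Unique l → Unique l' →
                  (∀ x → (x ∈ l → x ∈ l') × (x ∈ l' → x ∈ l)) → length l ≡ length l'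
unique-length-≡ {l = l} {l'} l! l'! l≋l' = ≤-antisym
  (unique-length-≤ l l' l! (λ x → proj₁ (l≋l' x))) (unique-length-≤ l' l l'! (λ x → proj₂ (l≋l' x)))

h≡length : ∀ {n} (λs T : List (Point n)) d → Unique λs → Unique T →
           (∀ x → x ∈ λs → deg x ≡ d → x ∈ T) → (∀ x → x ∈ T → x ∈ λs × deg x ≡ d) →
           h λs d ≡ length T
h≡length λs T d λs! T! ⇒T T⇒ = unique-length-≡ (UP.filter⁺ (λ x → deg x ≟ d) λs!) T! λ x →
  (λ x∈ → let (x∈λs , deg≡d) = ∈-filter⁻ (λ x → deg x ≟ d) x∈ in ⇒T x x∈λs deg≡d) ,
  (λ x∈T → let (x∈λs , deg≡d) = T⇒ x x∈T in ∈-filter⁺ (λ x → deg x ≟ d) x∈λs deg≡d)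

indicator : ∀ {P : Set} → Dec P → ℕ
indicator (yes _) = 1
indicator (no _)  = 0

h-∷ : ∀ {n} (x : Point n) l d → h (x ∷ l) d ≡ indicator (deg x ≟ d) + h l d
h-∷ x l d with deg x ≟ d
... | yes p  = cong length (LP.filter-accept (λ y → deg y ≟ d) {x} {l} p)
... | no  ¬p = cong length (LP.filter-reject (λ y → deg y ≟ d) {x} {l} ¬p)

h≥3-∷ : ∀ {n} (x : Point n) l → h≥3 (x ∷ l) ≡ indicator (3 ≤? deg x) + h≥3 l
h≥3-∷ x l with 3 ≤? deg x
... | yes p  = cong length (LP.filter-accept (λ y → 3 ≤? deg y) {x} {l} p)
... | no  ¬p = cong length (LP.filter-reject (λ y → 3 ≤? deg y) {x} {l} ¬p)

one-degree-class : ∀ r →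
  indicator (r ≟ 0) + indicator (r ≟ 1) + indicator (r ≟ 2) + indicator (3 ≤? r) ≡ 1
one-degree-class 0                   = refl
one-degree-class 1                   = refl
one-degree-class 2                   = refl
one-degree-class (suc (suc (suc r))) = refl

length-by-degree : ∀ {n} (l : List (Point n)) → length l ≡ h l 0 + h l 1 + h l 2 + h≥3 l
length-by-degree []      = refl
length-by-degree (x ∷ l) = begin
  suc (length l)
    ≡⟨ cong suc (length-by-degree l) ⟩
  1 + (h l 0 + h l 1 + h l 2 + h≥3 l)
    ≡⟨ cong (_+ (h l 0 + h l 1 + h l 2 + h≥3 l)) (sym (one-degree-class (deg x))) ⟩
  (ι₀ + ι₁ + ι₂ + ι₃) + (h l 0 + h l 1 + h l 2 + h≥3 l)
    ≡⟨ interchange ι₀ ι₁ ι₂ ι₃ (h l 0) (h l 1) (h l 2) (h≥3 l) ⟩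
  (ι₀ + h l 0) + (ι₁ + h l 1) + (ι₂ + h l 2) + (ι₃ + h≥3 l)
    ≡⟨ sym (cong₂ _+_ (cong₂ _+_ (cong₂ _+_ (h-∷ x l 0) (h-∷ x l 1)) (h-∷ x l 2)) (h≥3-∷ x l)) ⟩
  h (x ∷ l) 0 + h (x ∷ l) 1 + h (x ∷ l) 2 + h≥3 (x ∷ l) ∎
  where
  open ≡-Reasoning
  ι₀ ι₁ ι₂ ι₃ : ℕ
  ι₀ = indicator (deg x ≟ 0)
  ι₁ = indicator (deg x ≟ 1)
  ι₂ = indicator (deg x ≟ 2)
  ι₃ = indicator (3 ≤? deg x)
  interchange : ∀ a b c d p q r s →
                (a + b + c + d) + (p + q + r + s) ≡ (a + p) + (b + q) + (c + r) + (d + s)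
  interchange = solve-∀

length-map-allFin : ∀ {X : Set} n (f : Fin n → X) → length (L.map f (allFin n)) ≡ n
length-map-allFin n f = trans (LP.length-map f (allFin n)) (LP.length-tabulate {n = n} (λ q → q))

deg2Target-unique : ∀ k → Unique (deg2Target k)
deg2Target-unique k = UP.map⁺ (λ eq → e-injective (+ᵥ-cancelˡ _ _ _ eq)) (UP.allFin⁺ (suc k))

-- Definitionally, pad (a ∷ 0ᵥ) = a ∷ 0ᵥ and pad (a ∷ e t) = a ∷ e (suc t).
pad : ∀ {k} → Point (suc k) → Point (suc (suc k))
pad (a ∷ v) = a ∷ 0 ∷ v

pad-injective : ∀ {k} {x y : Point (suc k)} → pad x ≡ pad y → x ≡ y
pad-injective {x = _ ∷ _} {y = _ ∷ _} refl = refl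

Comb : (k i : ℕ) → Vec ℕ k → List (Point (suc k))
Comb zero    i []      = L.map (_∷ []) (upTo (2 + i))
Comb (suc k) i (b ∷ c) = L.map (_∷ e F.zero) (upTo (3 + b)) L.++ L.map pad (Comb k i c)

data InComb {k} (i : ℕ) (c : Vec ℕ k) : Point (suc k) → Set where
  spine : ∀ {a} → a ≤ suc i → InComb i c (a ∷ 0ᵥ)
  tooth : ∀ t {a} → a ≤ suc (suc (lookup c t)) → InComb i c (a ∷ e t)

∈Comb⁻ : ∀ k {i} c {x} → x ∈ Comb k i c → InComb i c x
∈Comb⁻ zero    []      x∈ with ∈-map⁻ (_∷ []) x∈
... | _ , a∈ , refl = spine (≤-pred (∈-upTo⁻ a∈))
∈Comb⁻ (suc k) (b ∷ c) x∈ with ∈-++⁻ (L.map (_∷ e F.zero) (upTo (3 + b))) x∈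
... | inj₁ x∈tooth with ∈-map⁻ (_∷ e F.zero) x∈tooth
...   | _ , a∈ , refl = tooth F.zero (≤-pred (∈-upTo⁻ a∈))
∈Comb⁻ (suc k) (b ∷ c) x∈ | inj₂ x∈rest with ∈-map⁻ pad x∈rest
...   | y , y∈ , refl with ∈Comb⁻ k c y∈
...     | spine a≤   = spine a≤
...     | tooth t a≤ = tooth (F.suc t) a≤

∈Comb⁺ : ∀ k {i} c {x} → InComb i c x → x ∈ Comb k i c
∈Comb⁺ zero    []      (spine a≤) = ∈-map⁺ (_∷ []) (∈-upTo⁺ (s≤s a≤))
∈Comb⁺ (suc k) (b ∷ c) (spine a≤) =
  ∈-++⁺ʳ (L.map (_∷ e F.zero) (upTo (3 + b))) (∈-map⁺ pad (∈Comb⁺ k c (spine a≤)))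
∈Comb⁺ (suc k) (b ∷ c) (tooth F.zero a≤) = ∈-++⁺ˡ (∈-map⁺ (_∷ e F.zero) (∈-upTo⁺ (s≤s a≤)))
∈Comb⁺ (suc k) (b ∷ c) (tooth (F.suc t) a≤) =
  ∈-++⁺ʳ (L.map (_∷ e F.zero) (upTo (3 + b))) (∈-map⁺ pad (∈Comb⁺ k c (tooth t a≤)))

Comb-unique : ∀ k i c → Unique (Comb k i c)
Comb-unique zero    i []      = UP.map⁺ VP.∷-injectiveˡ (UP.upTo⁺ _)
Comb-unique (suc k) i (b ∷ c) =
  UP.++⁺ (UP.map⁺ VP.∷-injectiveˡ (UP.upTo⁺ _)) (UP.map⁺ pad-injective (Comb-unique k i c)) disjoint
  where
  disjoint : ∀ {v} → ¬ (v ∈ L.map (_∷ e F.zero) (upTo (3 + b)) × v ∈ L.map pad (Comb k i c))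
  disjoint (v∈tooth , v∈rest) with ∈-map⁻ (_∷ e F.zero) v∈tooth | ∈-map⁻ pad v∈rest
  ... | _ , _ , refl | _ ∷ _ , _ , ()

length-Comb : ∀ k i c → length (Comb k i c) ≡ 2 + i + 3 * k + V.sum c
length-Comb zero i [] = begin
  length (L.map (_∷ []) (upTo (2 + i))) ≡⟨ LP.length-map _ (upTo (2 + i)) ⟩
  length (upTo (2 + i))                 ≡⟨ LP.length-upTo (2 + i) ⟩
  2 + i                                 ≡⟨ sym (+-identityʳ _) ⟩
  2 + i + 3 * 0                         ≡⟨ sym (+-identityʳ _) ⟩
  2 + i + 3 * 0 + 0                     ∎
  where open ≡-Reasoning
length-Comb (suc k) i (b ∷ c) = begin
  length (L.map (_∷ e F.zero) (upTo (3 + b)) L.++ L.map pad (Comb k i c))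
    ≡⟨ LP.length-++ (L.map (_∷ e F.zero) (upTo (3 + b))) ⟩
  length (L.map (_∷ e F.zero) (upTo (3 + b))) + length (L.map pad (Comb k i c))
    ≡⟨ cong₂ _+_ (trans (LP.length-map _ (upTo (3 + b))) (LP.length-upTo (3 + b)))
                 (trans (LP.length-map pad (Comb k i c)) (length-Comb k i c)) ⟩
  3 + b + (2 + i + 3 * k + V.sum c)
    ≡⟨ rearrange b i k (V.sum c) ⟩
  2 + i + 3 * suc k + (b + V.sum c) ∎
  where
  open ≡-Reasoning
  rearrange : ∀ b i k s → 3 + b + (2 + i + 3 * k + s) ≡ 2 + i + 3 * suc k + (b + s)
  rearrange = solve-∀

comb-size⇔ : ∀ k i c m → (length (Comb k i c) ≡ 1 + suc k + suc k + m → suc m ≡ i + k + V.sum c)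
                       × (suc m ≡ i + k + V.sum c → length (Comb k i c) ≡ 1 + suc k + suc k + m)
comb-size⇔ k i c m = ⇒ , ⇐
  where
  open ≡-Reasoning
  N : ℕ
  N = 1 + suc k + suc k
  suc-length : suc (length (Comb k i c)) ≡ N + (i + k + V.sum c)
  suc-length = trans (cong suc (length-Comb k i c)) (rearrange i k (V.sum c))
    where
    rearrange : ∀ i k s → suc (2 + i + 3 * k + s) ≡ 1 + suc k + suc k + (i + k + s)
    rearrange = solve-∀
  ⇒ : length (Comb k i c) ≡ N + m → suc m ≡ i + k + V.sum c
  ⇒ eq = +-cancelˡ-≡ N _ _ (begin
    N + suc m                 ≡⟨ +-suc N m ⟩
    suc (N + m)               ≡⟨ cong suc (sym eq) ⟩
    suc (length (Comb k i c)) ≡⟨ suc-length ⟩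
    N + (i + k + V.sum c)     ∎)
  ⇐ : suc m ≡ i + k + V.sum c → length (Comb k i c) ≡ N + m
  ⇐ eq = suc-injective (begin
    suc (length (Comb k i c)) ≡⟨ suc-length ⟩
    N + (i + k + V.sum c)     ≡⟨ cong (N +_) (sym eq) ⟩
    N + suc m                 ≡⟨ +-suc N m ⟩
    suc (N + m)               ∎)

InComb-downward : ∀ {k i} {c : Vec ℕ k} → (∀ t → lookup c t < i) →
                  ∀ {x} y → InComb i c x → y ≤ᵥ x → InComb i c y
InComb-downward c< (b ∷ w) (spine a≤) y≤ with ≤ᵥ0ᵥ w (≤ᵥ-tail y≤)
... | refl = spine (≤-trans (y≤ F.zero) a≤)
InComb-downward c< (b ∷ w) (tooth t a≤) y≤ with ≤ᵥe w t (≤ᵥ-tail y≤)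
... | inj₁ refl = spine (≤-trans (y≤ F.zero) (≤-trans a≤ (s≤s (c< t))))
... | inj₂ refl = tooth t (≤-trans (y≤ F.zero) a≤)

Comb-isPartition : ∀ k {i} (c : Vec ℕ k) → (∀ t → lookup c t < i) → IsPartition (Comb k i c)
Comb-isPartition k c c< =
  Comb-unique k _ c , λ x x∈ y y≤x → ∈Comb⁺ k c (InComb-downward c< y (∈Comb⁻ k c x∈) y≤x)

-- The spine top (i + 1)e₁ has degree ≥ 3 unless i ≤ 1, and then it lies
-- below any tooth top.
Comb-socle : ∀ k {i} (c : Vec ℕ k) → 2 ≤ i ⊎ Fin k →
             ∀ x → x ∈ Comb k i c → IsMaximal (Comb k i c) x → 3 ≤ deg x
Comb-socle k {i} c 2≤i⊎tooth x x∈ x-max with ∈Comb⁻ k c x∈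
... | spine {a} a≤ with a ≤? i
...   | yes a≤i = ⊥-elim (1+n≢n (VP.∷-injectiveˡ
          (x-max (suc a ∷ 0ᵥ) (∈Comb⁺ k c (spine (s≤s a≤i))) (≤ᵥ-∷ (n≤1+n a) (≤ᵥ-refl {v = 0ᵥ})))))
...   | no  a≰i with ≤-antisym a≤ (≰⇒> a≰i)
...     | refl = subst (3 ≤_) (sym (deg-spine k a)) (spine-top 2≤i⊎tooth)
  where
  spine-top : 2 ≤ i ⊎ Fin k → 3 ≤ suc i
  spine-top (inj₁ 2≤i) = s≤s 2≤i
  spine-top (inj₂ t) with 2 ≤? i
  ... | yes 2≤i = s≤s 2≤i
  ... | no  2≰i = ⊥-elim (e≢0ᵥ t (VP.∷-injectiveʳ
          (x-max (suc i ∷ e t) (∈Comb⁺ k c (tooth t (s≤s (≤-trans (≤-pred (≰⇒> 2≰i)) (s≤s z≤n)))))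
                 (≤ᵥ-∷ ≤-refl (0ᵥ≤ᵥ (e t))))))
Comb-socle k c _ x x∈ x-max | tooth t {a} a≤ with a ≤? suc (lookup c t)
... | yes a≤ct = ⊥-elim (1+n≢n (VP.∷-injectiveˡ
        (x-max (suc a ∷ e t) (∈Comb⁺ k c (tooth t (s≤s a≤ct)))
               (≤ᵥ-∷ (n≤1+n a) (≤ᵥ-refl {v = e t})))))
... | no  a≰ct = subst (3 ≤_) (sym (deg-tooth a t)) (s≤s (≤-trans (s≤s (s≤s z≤n)) (≰⇒> a≰ct)))

Comb-deg2 : ∀ k {i} (c : Vec ℕ k) → 1 ≤ i → Deg2Standard k (Comb k i c)
Comb-deg2 k {i} c 1≤i x = deg2⇒target , target⇒deg2
  where
  target : Fin (suc k) → Point (suc k)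
  target q = e F.zero +ᵥ e q
  deg2⇒target : x ∈ Comb k i c × deg x ≡ 2 → x ∈ deg2Target k
  deg2⇒target (x∈ , deg≡2) with ∈Comb⁻ k c x∈
  ... | spine {a} _ with trans (sym (deg-spine k a)) deg≡2
  ...   | refl = subst (_∈ deg2Target k) e₀+ᵥe₀ (∈-map⁺ target (∈-allFin F.zero))
  deg2⇒target (x∈ , deg≡2) | tooth t {a} _ with suc-injective (trans (sym (deg-tooth a t)) deg≡2)
  ...   | refl = subst (_∈ deg2Target k) (e₀+ᵥe-suc t) (∈-map⁺ target (∈-allFin (F.suc t)))
  target⇒deg2 : x ∈ deg2Target k → x ∈ Comb k i c × deg x ≡ 2
  target⇒deg2 x∈ with ∈-map⁻ target {xs = allFin (suc k)} x∈
  ... | F.zero , _ , refl = subst (λ z → z ∈ Comb k i c × deg z ≡ 2) (sym e₀+ᵥe₀)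
          (∈Comb⁺ k c (spine (s≤s 1≤i)) , deg-spine k 2)
  ... | F.suc t , _ , refl = subst (λ z → z ∈ Comb k i c × deg z ≡ 2) (sym (e₀+ᵥe-suc t))
          (∈Comb⁺ k c (tooth t (s≤s z≤n)) , deg-tooth 1 t)

-- Combs are δ-partitions

Comb-h₀ : ∀ k {i} (c : Vec ℕ k) → h (Comb k i c) 0 ≡ 1
Comb-h₀ k c = h≡length (Comb k _ c) ((0 ∷ 0ᵥ) ∷ []) 0 (Comb-unique k _ c) (All.[] AP.∷ AP.[]) ⇒T T⇒
  where
  ⇒T : ∀ x → x ∈ Comb k _ c → deg x ≡ 0 → x ∈ (0 ∷ 0ᵥ) ∷ []
  ⇒T x x∈ deg≡0 with ∈Comb⁻ k c x∈
  ... | spine {a} _ with trans (sym (deg-spine k a)) deg≡0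
  ...   | refl = here refl
  ⇒T x x∈ deg≡0 | tooth t {a} _ with trans (sym (deg-tooth a t)) deg≡0
  ...   | ()
  T⇒ : ∀ x → x ∈ (0 ∷ 0ᵥ) ∷ [] → x ∈ Comb k _ c × deg x ≡ 0
  T⇒ x (here refl) = ∈Comb⁺ k c (spine z≤n) , deg-spine k 0

Comb-h₁ : ∀ k {i} (c : Vec ℕ k) → h (Comb k i c) 1 ≡ suc k
Comb-h₁ k c = trans (h≡length (Comb k _ c) (L.map e (allFin (suc k))) 1 (Comb-unique k _ c)
                               (UP.map⁺ e-injective (UP.allFin⁺ (suc k))) ⇒T T⇒)
                    (length-map-allFin (suc k) e)
  where
  ⇒T : ∀ x → x ∈ Comb k _ c → deg x ≡ 1 → x ∈ L.map e (allFin (suc k))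
  ⇒T x x∈ deg≡1 with ∈Comb⁻ k c x∈
  ... | spine {a} _ with trans (sym (deg-spine k a)) deg≡1
  ...   | refl = ∈-map⁺ e (∈-allFin F.zero)
  ⇒T x x∈ deg≡1 | tooth t {a} _ with suc-injective (trans (sym (deg-tooth a t)) deg≡1)
  ...   | refl = ∈-map⁺ e (∈-allFin (F.suc t))
  T⇒ : ∀ x → x ∈ L.map e (allFin (suc k)) → x ∈ Comb k _ c × deg x ≡ 1
  T⇒ x x∈ with ∈-map⁻ e {xs = allFin (suc k)} x∈
  ... | F.zero  , _ , refl = ∈Comb⁺ k c (spine (s≤s z≤n)) , deg-spine k 1
  ... | F.suc t , _ , refl = ∈Comb⁺ k c (tooth t z≤n) , deg-tooth 0 t

Comb-h₂ : ∀ k {i} (c : Vec ℕ k) → 1 ≤ i → h (Comb k i c) 2 ≡ suc k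
Comb-h₂ k c 1≤i = trans
  (h≡length (Comb k _ c) (deg2Target k) 2 (Comb-unique k _ c) (deg2Target-unique k)
            (λ x x∈ deg≡2 → proj₁ (Comb-deg2 k c 1≤i x) (x∈ , deg≡2))
            (λ x x∈ → proj₂ (Comb-deg2 k c 1≤i x) x∈))
  (length-map-allFin (suc k) _)

Comb-δ : ∀ k m {i} (c : Vec ℕ k) → Shape k m (i , c) → 2 ≤ i ⊎ Fin k → 1 ≤ m →
         DeltaSet k m (Comb k i c)
Comb-δ k m {i} c (1≤i , c< , size) 2≤i⊎tooth 1≤m =
  ( s≤s z≤n , s≤s z≤n , 1≤m , Comb-isPartition k c c< , length≡ , Comb-socle k c 2≤i⊎tooth
  , Comb-h₁ k c , Comb-h₂ k c 1≤i , h≥3≡ ) , Comb-deg2 k c 1≤i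
  where
  Λ : List (Point (suc k))
  Λ = Comb k i c
  length≡ : length Λ ≡ 1 + suc k + suc k + m
  length≡ = proj₂ (comb-size⇔ k i c m) size
  h≥3≡ : h≥3 Λ ≡ m
  h≥3≡ = +-cancelˡ-≡ (1 + suc k + suc k) (h≥3 Λ) m (begin
    1 + suc k + suc k + h≥3 Λ     ≡⟨ cong (_+ h≥3 Λ) (sym h₀+h₁+h₂) ⟩
    h Λ 0 + h Λ 1 + h Λ 2 + h≥3 Λ ≡⟨ sym (length-by-degree Λ) ⟩
    length Λ                      ≡⟨ length≡ ⟩
    1 + suc k + suc k + m         ∎)
    where
    open ≡-Reasoning
    h₀+h₁+h₂ : h Λ 0 + h Λ 1 + h Λ 2 ≡ 1 + suc k + suc k
    h₀+h₁+h₂ = cong₂ _+_ (cong₂ _+_ (Comb-h₀ k c) (Comb-h₁ k c)) (Comb-h₂ k c 1≤i)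

Comb-injective : ∀ k {i i'} (c c' : Vec ℕ k) → Comb k i c ≋ Comb k i' c' → (i , c) ≡ (i' , c')
Comb-injective k {i} {i'} c c' Comb≋ = cong₂ _,_
  (suc-injective (≤-antisym (spine-top⊆ Comb≋) (spine-top⊆ (λ x → swap (Comb≋ x)))))
  (lookup-extensional λ t → ≤-antisym (tooth-top⊆ Comb≋ t) (tooth-top⊆ (λ x → swap (Comb≋ x)) t))
  where
  spine⁻ : ∀ {i} {c : Vec ℕ k} {x a} → InComb i c x → x ≡ a ∷ 0ᵥ → a ≤ suc i
  spine⁻ (spine a≤)   refl = a≤
  spine⁻ (tooth t _)  eq   = ⊥-elim (e≢0ᵥ t (VP.∷-injectiveʳ eq))
  tooth⁻ : ∀ {i} {c : Vec ℕ k} {x a} t → InComb i c x → x ≡ a ∷ e t → a ≤ suc (suc (lookup c t))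
  tooth⁻ t (spine _)     eq = ⊥-elim (e≢0ᵥ t (sym (VP.∷-injectiveʳ eq)))
  tooth⁻ t (tooth t' a≤) eq with e-injective (VP.∷-injectiveʳ eq) | VP.∷-injectiveˡ eq
  ... | refl | refl = a≤
  spine-top⊆ : ∀ {i i'} {c c' : Vec ℕ k} → Comb k i c ≋ Comb k i' c' → suc i ≤ suc i'
  spine-top⊆ {c = c} {c'} Comb≋ =
    spine⁻ (∈Comb⁻ k c' (proj₁ (Comb≋ _) (∈Comb⁺ k c (spine ≤-refl)))) refl
  tooth-top⊆ : ∀ {i i'} {c c' : Vec ℕ k} → Comb k i c ≋ Comb k i' c' →
               ∀ t → lookup c t ≤ lookup c' t
  tooth-top⊆ {c = c} {c'} Comb≋ t =
    ≤-pred (≤-pred (tooth⁻ t (∈Comb⁻ k c' (proj₁ (Comb≋ _) (∈Comb⁺ k c (tooth t ≤-refl)))) refl))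

-- Every δ-partition is a comb

height : ∀ {k} → Vec ℕ k → Point (suc k) → ℕ
height w (a ∷ v) with VP.≡-dec _≟_ v w
... | yes _ = a
... | no  _ = 0

height-∷ : ∀ {k} (w : Vec ℕ k) a → height w (a ∷ w) ≡ a
height-∷ w a with VP.≡-dec _≟_ w w
... | yes _   = refl
... | no  w≢w = ⊥-elim (w≢w refl)

height-pos : ∀ {k} (w : Vec ℕ k) x → 1 ≤ height w x → x ≡ height w x ∷ w
height-pos w (a ∷ v) 1≤ with VP.≡-dec _≟_ v w
... | yes refl = refl
height-pos w (a ∷ v) () | no _

module Ray {k} (λs : List (Point (suc k))) (w : Vec ℕ k) (base∈ : (1 ∷ w) ∈ λs) where

  top : Point (suc k)
  top = argmax (height w) (1 ∷ w) λs

  rayHeight : ℕ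
  rayHeight = height w top

  top∈ : top ∈ λs
  top∈ = argmax-all (height w) {P = _∈ λs} base∈ (All.tabulate (λ x∈ → x∈))

  1≤rayHeight : 1 ≤ rayHeight
  1≤rayHeight = subst (_≤ rayHeight) (height-∷ w 1) (f[⊥]≤f[argmax] {f = height w} (1 ∷ w) λs)

  top≡ : top ≡ rayHeight ∷ w
  top≡ = height-pos w top 1≤rayHeight

  ≤rayHeight : ∀ {a} → (a ∷ w) ∈ λs → a ≤ rayHeight
  ≤rayHeight {a} a∈ = subst (_≤ rayHeight) (height-∷ w a)
    (All.lookup (f[xs]≤f[argmax] {f = height w} (1 ∷ w) λs) a∈)

  rayHeight∈ : (rayHeight ∷ w) ∈ λs
  rayHeight∈ = subst (_∈ λs) top≡ top∈

data SpineOrTooth {k} : Point (suc k) → Set where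
  onSpine : ∀ a → SpineOrTooth (a ∷ 0ᵥ)
  onTooth : ∀ t a → SpineOrTooth (a ∷ e t)

module Completeness {k m} {λs : List (Point (suc k))}
  (λs! : Unique λs) (down : ∀ x → x ∈ λs → ∀ y → y ≤ᵥ x → y ∈ λs)
  (size : length λs ≡ 1 + suc k + suc k + m)
  (socle : ∀ x → x ∈ λs → IsMaximal λs x → 3 ≤ deg x) (deg2 : Deg2Standard k λs) where

  target∈ : ∀ q → e F.zero +ᵥ e q ∈ λs
  target∈ q = proj₁ (proj₂ (deg2 _) (∈-map⁺ (λ q → e F.zero +ᵥ e q) (∈-allFin q)))

  -- A tail of degree ≥ 2 would put x above a degree-2 point with first coordinate 0.
  spineOrTooth : ∀ x → x ∈ λs → SpineOrTooth x
  spineOrTooth (a ∷ v) x∈ with deg v ≤? 1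
  ... | yes deg≤1 with deg≤1⇒0ᵥ⊎e v deg≤1
  ...   | inj₁ refl       = onSpine a
  ...   | inj₂ (t , refl) = onTooth t a
  spineOrTooth (a ∷ v) x∈ | no deg≰1 with below-of-degree 2 v (≰⇒> deg≰1)
  ... | w , w≤v , deg-w with ∈-map⁻ (λ q → e F.zero +ᵥ e q) {xs = allFin (suc k)}
         (proj₁ (deg2 (0 ∷ w)) (down (a ∷ v) x∈ (0 ∷ w) (≤ᵥ-∷ z≤n w≤v) , deg-w))
  ...   | F.zero  , _ , ()
  ...   | F.suc _ , _ , ()

  2e₁∈ : (2 ∷ 0ᵥ) ∈ λs
  2e₁∈ = subst (_∈ λs) e₀+ᵥe₀ (target∈ F.zero)

  e₁+e∈ : ∀ t → (1 ∷ e t) ∈ λs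
  e₁+e∈ t = subst (_∈ λs) (e₀+ᵥe-suc t) (target∈ (F.suc t))

  module Spine = Ray λs 0ᵥ (down _ 2e₁∈ (1 ∷ 0ᵥ) (≤ᵥ-∷ (s≤s z≤n) (≤ᵥ-refl {v = 0ᵥ})))
  module Tooth (t : Fin k) = Ray λs (e t) (e₁+e∈ t)

  2≤spine : 2 ≤ Spine.rayHeight
  2≤spine = Spine.≤rayHeight 2e₁∈

  tooth≤spine : ∀ t → Tooth.rayHeight t ≤ Spine.rayHeight
  tooth≤spine t = Spine.≤rayHeight (down _ (Tooth.rayHeight∈ t) _ (≤ᵥ-∷ ≤-refl (0ᵥ≤ᵥ (e t))))

  -- Otherwise e₁ + e_t would be a maximal point of degree 2.
  2≤tooth : ∀ t → 2 ≤ Tooth.rayHeight t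
  2≤tooth t with 2 ≤? Tooth.rayHeight t
  ... | yes 2≤ = 2≤
  ... | no  2≰ = ⊥-elim (3≰2 (subst (3 ≤_) (deg-tooth 1 t) (socle (1 ∷ e t) (e₁+e∈ t) maximal)))
    where
    3≰2 : ¬ 3 ≤ 2
    3≰2 (s≤s (s≤s ()))
    maximal : IsMaximal λs (1 ∷ e t)
    maximal y y∈ ≥ with spineOrTooth y y∈
    ... | onSpine a   = ⊥-elim (e≢0ᵥ t (≤ᵥ0ᵥ (e t) (≤ᵥ-tail ≥)))
    ... | onTooth t' a with e≤ᵥe⇒≡ t t' (≤ᵥ-tail ≥)
    ...   | refl = cong (_∷ e t)
                     (≤-antisym (≤-trans (Tooth.≤rayHeight t y∈) (≤-pred (≰⇒> 2≰))) (≥ F.zero))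

  i : ℕ
  i = Spine.rayHeight ∸ 1

  c : Vec ℕ k
  c = tabulate (λ t → Tooth.rayHeight t ∸ 2)

  suc-i : suc i ≡ Spine.rayHeight
  suc-i = m+[n∸m]≡n (≤-trans (s≤s z≤n) 2≤spine)

  suc-suc-c : ∀ t → suc (suc (lookup c t)) ≡ Tooth.rayHeight t
  suc-suc-c t = trans (cong (λ z → suc (suc z)) (VP.lookup∘tabulate _ t)) (m+[n∸m]≡n (2≤tooth t))

  ≋Comb : λs ≋ Comb k i c
  ≋Comb x = (λ x∈ → ∈Comb⁺ k c (⇒InComb x∈ (spineOrTooth x x∈))) , λ x∈ → InComb⇒ (∈Comb⁻ k c x∈)
    where
    ⇒InComb : ∀ {x} → x ∈ λs → SpineOrTooth x → InComb i c x
    ⇒InComb x∈ (onSpine a)   = spine (subst (a ≤_) (sym suc-i) (Spine.≤rayHeight x∈))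
    ⇒InComb x∈ (onTooth t a) = tooth t (subst (a ≤_) (sym (suc-suc-c t)) (Tooth.≤rayHeight t x∈))
    InComb⇒ : ∀ {x} → InComb i c x → x ∈ λs
    InComb⇒ (spine a≤)   = down _ Spine.rayHeight∈ _
                             (≤ᵥ-∷ (subst (_ ≤_) suc-i a≤) (≤ᵥ-refl {v = 0ᵥ}))
    InComb⇒ (tooth t a≤) = down _ (Tooth.rayHeight∈ t) _
                             (≤ᵥ-∷ (subst (_ ≤_) (suc-suc-c t) a≤) (≤ᵥ-refl {v = e t}))

  shape : Shape k m (i , c)
  shape = ∸-monoˡ-≤ 1 2≤spine
        , (λ t → ≤-pred (subst₂ _≤_ (sym (suc-suc-c t)) (sym suc-i) (tooth≤spine t)))
        , proj₁ (comb-size⇔ k i c m)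
            (trans (sym (unique-length-≡ λs! (Comb-unique k i c) ≋Comb)) size)

δ⇒Comb : ∀ k m λs → DeltaSet k m λs → ∃[ s ] Shape k m s × λs ≋ Comb k (proj₁ s) (proj₂ s)
δ⇒Comb k m λs ((_ , _ , _ , (λs! , down) , size , socle , _ , _ , _) , deg2) =
  (i , c) , shape , ≋Comb
  where open Completeness λs! down size socle deg2

-- Moving the spine to another coordinate

relocate : ∀ {k} → Fin (suc k) → Point (suc k) → Point (suc k)
relocate p (a ∷ v) = insertAt v p a

relocate⁻¹ : ∀ {k} → Fin (suc k) → Point (suc k) → Point (suc k)
relocate⁻¹ p y = lookup y p ∷ removeAt y p

relocate-relocate⁻¹ : ∀ {k} (p : Fin (suc k)) y → relocate p (relocate⁻¹ p y) ≡ y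
relocate-relocate⁻¹ p y = VP.insertAt-removeAt y p

relocate⁻¹-relocate : ∀ {k} (p : Fin (suc k)) x → relocate⁻¹ p (relocate p x) ≡ x
relocate⁻¹-relocate p (a ∷ v) = cong₂ _∷_ (VP.insertAt-lookup v p a) (VP.removeAt-insertAt v p a)

relocate-injective : ∀ {k} (p : Fin (suc k)) {x y} → relocate p x ≡ relocate p y → x ≡ y
relocate-injective p {x} {y} eq =
  trans (sym (relocate⁻¹-relocate p x)) (trans (cong (relocate⁻¹ p) eq) (relocate⁻¹-relocate p y))

lookup-relocate-p : ∀ {k} (p : Fin (suc k)) a v → lookup (relocate p (a ∷ v)) p ≡ a
lookup-relocate-p p a v = VP.insertAt-lookup v p a

lookup-relocate-punchIn : ∀ {k} (p : Fin (suc k)) a v r →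
                          lookup (relocate p (a ∷ v)) (punchIn p r) ≡ lookup v r
lookup-relocate-punchIn p a v r = VP.insertAt-punchIn v p a r

≡⊎punchIn : ∀ {k} (p q : Fin (suc k)) → q ≡ p ⊎ ∃[ r ] q ≡ punchIn p r
≡⊎punchIn p q with p FP.≟ q
... | yes p≡q = inj₁ (sym p≡q)
... | no  p≢q = inj₂ (punchOut p≢q , sym (FP.punchIn-punchOut p≢q))

relocate-mono : ∀ {k} (p : Fin (suc k)) x y → x ≤ᵥ y → relocate p x ≤ᵥ relocate p y
relocate-mono p (a ∷ v) (b ∷ w) x≤y q with ≡⊎punchIn p q
... | inj₁ refl       =
  subst₂ _≤_ (sym (lookup-relocate-p p a v)) (sym (lookup-relocate-p p b w)) (x≤y F.zero)
... | inj₂ (r , refl) =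
  subst₂ _≤_ (sym (lookup-relocate-punchIn p a v r)) (sym (lookup-relocate-punchIn p b w r))
    (x≤y (F.suc r))

relocate-mono⁻ : ∀ {k} (p : Fin (suc k)) x y → relocate p x ≤ᵥ relocate p y → x ≤ᵥ y
relocate-mono⁻ p (a ∷ v) (b ∷ w) le F.zero =
  subst₂ _≤_ (lookup-relocate-p p a v) (lookup-relocate-p p b w) (le p)
relocate-mono⁻ p (a ∷ v) (b ∷ w) le (F.suc r) =
  subst₂ _≤_ (lookup-relocate-punchIn p a v r) (lookup-relocate-punchIn p b w r) (le (punchIn p r))

≤relocate⇒relocate⁻¹≤ : ∀ {k} (p : Fin (suc k)) y x → y ≤ᵥ relocate p x → relocate⁻¹ p y ≤ᵥ x
≤relocate⇒relocate⁻¹≤ p y x le =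
  relocate-mono⁻ p (relocate⁻¹ p y) x (subst (_≤ᵥ relocate p x) (sym (relocate-relocate⁻¹ p y)) le)

deg-relocate : ∀ {k} (p : Fin (suc k)) x → deg (relocate p x) ≡ deg x
deg-relocate p (a ∷ v) = sum-insertAt v p a
  where
  sum-insertAt : ∀ {n} (v : Vec ℕ n) p a → V.sum (insertAt v p a) ≡ a + V.sum v
  sum-insertAt v       F.zero    a = refl
  sum-insertAt (x ∷ v) (F.suc p) a =
    trans (cong (x +_) (sum-insertAt v p a)) (x∙yz≈y∙xz x a (V.sum v))

length-filter-map : ∀ {X : Set} {P : X → Set} (P? : ∀ x → Dec (P x)) (f : X → X) →
                    (∀ x → (P (f x) → P x) × (P x → P (f x))) →
                    ∀ l → length (filter P? (L.map f l)) ≡ length (filter P? l)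
length-filter-map P? f P∘f⇔P [] = refl
length-filter-map P? f P∘f⇔P (x ∷ l) with P? x
... | yes px = trans (cong length (LP.filter-accept P? {f x} {L.map f l} (proj₂ (P∘f⇔P x) px)))
                     (cong suc (length-filter-map P? f P∘f⇔P l))
... | no ¬px = trans (cong length (LP.filter-reject P? {f x} {L.map f l} (¬px ∘′ proj₁ (P∘f⇔P x))))
                     (length-filter-map P? f P∘f⇔P l)

MPartition-relocate : ∀ {k m} (p : Fin (suc k)) λs → MPartition (suc k) (suc k) m λs →
                      MPartition (suc k) (suc k) m (L.map (relocate p) λs)
MPartition-relocate p λs (1≤k , 1≤q , 1≤m , (λs! , down) , size , socle , h₁ , h₂ , h≥3) =
  1≤k , 1≤q , 1≤m , (UP.map⁺ (relocate-injective p) λs! , down′) ,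
  trans (LP.length-map (relocate p) λs) size , socle′ ,
  trans (h-relocate 1) h₁ , trans (h-relocate 2) h₂ ,
  trans (length-filter-map (λ x → 3 ≤? deg x) (relocate p) (deg-invariant (3 ≤_)) λs) h≥3
  where
  deg-invariant : (P : ℕ → Set) → ∀ x →
                  (P (deg (relocate p x)) → P (deg x)) × (P (deg x) → P (deg (relocate p x)))
  deg-invariant P x = subst P (deg-relocate p x) , subst P (sym (deg-relocate p x))
  h-relocate : ∀ d → h (L.map (relocate p) λs) d ≡ h λs d
  h-relocate d = length-filter-map (λ x → deg x ≟ d) (relocate p) (deg-invariant (_≡ d)) λs
  down′ : ∀ x → x ∈ L.map (relocate p) λs → ∀ y → y ≤ᵥ x → y ∈ L.map (relocate p) λs
  down′ x x∈ y y≤x with ∈-map⁻ (relocate p) x∈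
  ... | x' , x'∈ , refl = subst (_∈ L.map (relocate p) λs) (relocate-relocate⁻¹ p y)
    (∈-map⁺ (relocate p) (down x' x'∈ (relocate⁻¹ p y) (≤relocate⇒relocate⁻¹≤ p y x' y≤x)))
  socle′ : ∀ x → x ∈ L.map (relocate p) λs → IsMaximal (L.map (relocate p) λs) x → 3 ≤ deg x
  socle′ x x∈ x-max with ∈-map⁻ (relocate p) x∈
  ... | x' , x'∈ , refl = subst (3 ≤_) (sym (deg-relocate p x')) (socle x' x'∈ λ y y∈ x'≤y →
    relocate-injective p
      (x-max (relocate p y) (∈-map⁺ (relocate p) y∈) (relocate-mono p x' y x'≤y)))

relocate-0ᵥ : ∀ {k} (p : Fin (suc k)) → relocate p (0 ∷ 0ᵥ) ≡ 0ᵥ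
relocate-0ᵥ         F.zero    = refl
relocate-0ᵥ {suc k} (F.suc p) = cong (0 ∷_) (relocate-0ᵥ p)

e≡relocate : ∀ {k} (p : Fin (suc k)) → e p ≡ relocate p (1 ∷ 0ᵥ)
e≡relocate         F.zero    = refl
e≡relocate {suc k} (F.suc p) = cong (0 ∷_) (e≡relocate p)

e-punchIn≡relocate : ∀ {k} (p : Fin (suc k)) t → e (punchIn p t) ≡ relocate p (0 ∷ e t)
e-punchIn≡relocate F.zero    t         = refl
e-punchIn≡relocate (F.suc p) F.zero    = cong (1 ∷_) (sym (relocate-0ᵥ p))
e-punchIn≡relocate (F.suc p) (F.suc t) = cong (0 ∷_) (e-punchIn≡relocate p t)

relocate-+ᵥ : ∀ {k} (p : Fin (suc k)) x y → relocate p x +ᵥ relocate p y ≡ relocate p (x +ᵥ y)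
relocate-+ᵥ F.zero    (a ∷ v)     (b ∷ w)     = refl
relocate-+ᵥ (F.suc p) (a ∷ x ∷ v) (b ∷ y ∷ w) = cong (x + y ∷_) (relocate-+ᵥ p (a ∷ v) (b ∷ w))

relocate-·ᵥ : ∀ {k} (p : Fin (suc k)) b x → b ·ᵥ relocate p x ≡ relocate p (b ·ᵥ x)
relocate-·ᵥ p b (a ∷ v) = VP.map-insertAt (b *_) a v p

scale-e≡relocate : ∀ {k} (p : Fin (suc k)) b → b ·ᵥ e p ≡ relocate p (b ∷ 0ᵥ)
scale-e≡relocate {k} p b = begin
  b ·ᵥ e p                     ≡⟨ cong (b ·ᵥ_) (e≡relocate p) ⟩
  b ·ᵥ relocate p (1 ∷ 0ᵥ)     ≡⟨ relocate-·ᵥ p b (1 ∷ 0ᵥ) ⟩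
  relocate p (b * 1 ∷ b ·ᵥ 0ᵥ) ≡⟨ cong₂ (λ a v → relocate p (a ∷ v)) (*-identityʳ b) b·ᵥ0ᵥ ⟩
  relocate p (b ∷ 0ᵥ)          ∎
  where
  open ≡-Reasoning
  b·ᵥ0ᵥ : b ·ᵥ 0ᵥ ≡ 0ᵥ
  b·ᵥ0ᵥ = trans (VP.map-replicate (b *_) 0 k) (cong (replicate k) (*-zeroʳ b))

e+scale-e≡relocate : ∀ {k} (p : Fin (suc k)) b t →
                     e (punchIn p t) +ᵥ (b ·ᵥ e p) ≡ relocate p (b ∷ e t)
e+scale-e≡relocate p b t = begin
  e (punchIn p t) +ᵥ (b ·ᵥ e p)
    ≡⟨ cong₂ _+ᵥ_ (e-punchIn≡relocate p t) (scale-e≡relocate p b) ⟩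
  relocate p (0 ∷ e t) +ᵥ relocate p (b ∷ 0ᵥ)
    ≡⟨ relocate-+ᵥ p (0 ∷ e t) (b ∷ 0ᵥ) ⟩
  relocate p (b ∷ (e t +ᵥ 0ᵥ))
    ≡⟨ cong (λ v → relocate p (b ∷ v)) (+ᵥ0ᵥ (e t)) ⟩
  relocate p (b ∷ e t) ∎
  where open ≡-Reasoning

RelocatedComb : ∀ {k} → Fin (suc k) → ℕ → Vec ℕ k → List (Point (suc k))
RelocatedComb {k} p i c = L.map (relocate p) (Comb k i c)

data Corner {k} (i : ℕ) (c : Vec ℕ k) : Point (suc k) → Set where
  spineTop : Corner i c (suc i ∷ 0ᵥ)
  toothTop : ∀ t → Corner i c (suc (suc (lookup c t)) ∷ e t)

InComb⇒below-corner : ∀ {k i} {c : Vec ℕ k} {x} → InComb i c x → ∃[ z ] Corner i c z × x ≤ᵥ z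
InComb⇒below-corner (spine a≤)   = _ , spineTop  , ≤ᵥ-∷ a≤ (≤ᵥ-refl {v = 0ᵥ})
InComb⇒below-corner (tooth t a≤) = _ , toothTop t , ≤ᵥ-∷ a≤ (≤ᵥ-refl {v = e t})

corner-InComb : ∀ {k i} {c : Vec ℕ k} {z} → Corner i c z → InComb i c z
corner-InComb spineTop     = spine ≤-refl
corner-InComb (toothTop t) = tooth t ≤-refl

∈RelocatedComb⁻ : ∀ {k i} (c : Vec ℕ k) p {y} → y ∈ RelocatedComb p i c →
                  ∃[ z ] Corner i c z × y ≤ᵥ relocate p z
∈RelocatedComb⁻ {k} c p y∈ with ∈-map⁻ (relocate p) y∈
... | x , x∈ , refl with InComb⇒below-corner (∈Comb⁻ k c x∈)
... | z , corner , x≤z = z , corner , relocate-mono p x z x≤z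

∈RelocatedComb⁺ : ∀ {k i} (c : Vec ℕ k) p → (∀ t → lookup c t < i) →
                  ∀ y {z} → Corner i c z → y ≤ᵥ relocate p z → y ∈ RelocatedComb p i c
∈RelocatedComb⁺ {k} c p c< y {z} corner y≤ =
  subst (_∈ L.map (relocate p) (Comb k _ c)) (relocate-relocate⁻¹ p y)
    (∈-map⁺ (relocate p) (∈Comb⁺ k c
      (InComb-downward c< (relocate⁻¹ p y) (corner-InComb corner)
                       (≤relocate⇒relocate⁻¹≤ p y z y≤))))

-- headSet j α σ consists of the relocated corners of the comb with spine
-- height α₁ + 2 and tooth heights α_t + 2, read through σ.
module HeadSet (j : ℕ) (α : Vec ℕ (suc (suc j))) (σ : Permutation′ (suc (suc j)))
  (c : Vec ℕ (suc j)) (c≡ : ∀ t → lookup c t ≡ lookup α (σ ⟨$⟩ˡ punchIn (σ ⟨$⟩ʳ F.zero) t))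
  where

  p : Fin (suc (suc j))
  p = σ ⟨$⟩ʳ F.zero

  i : ℕ
  i = suc (lookup α F.zero)

  tooth-generator : Fin (suc j) → Point (suc (suc j))
  tooth-generator u = e (σ ⟨$⟩ʳ F.suc u) +ᵥ ((lookup α (F.suc u) + 2) ·ᵥ e p)

  spine-generator≡ : (lookup α F.zero + 2) ·ᵥ e p ≡ relocate p (suc i ∷ 0ᵥ)
  spine-generator≡ = trans (scale-e≡relocate p _) (cong (λ b → relocate p (b ∷ 0ᵥ)) (+-comm _ 2))

  tooth-generator≡ : ∀ u t → σ ⟨$⟩ʳ F.suc u ≡ punchIn p t →
                     tooth-generator u ≡ relocate p (suc (suc (lookup c t)) ∷ e t)
  tooth-generator≡ u t σu≡ = begin
    tooth-generator u
      ≡⟨ cong (λ q → e q +ᵥ ((lookup α (F.suc u) + 2) ·ᵥ e p)) σu≡ ⟩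
    e (punchIn p t) +ᵥ ((lookup α (F.suc u) + 2) ·ᵥ e p)
      ≡⟨ e+scale-e≡relocate p _ t ⟩
    relocate p ((lookup α (F.suc u) + 2) ∷ e t)
      ≡⟨ cong (λ b → relocate p (b ∷ e t))
              (trans (+-comm _ 2) (cong (λ a → suc (suc a)) (sym c≡α))) ⟩
    relocate p (suc (suc (lookup c t)) ∷ e t) ∎
    where
    open ≡-Reasoning
    c≡α : lookup c t ≡ lookup α (F.suc u)
    c≡α = trans (c≡ t)
            (trans (cong (λ q → lookup α (σ ⟨$⟩ˡ q)) (sym σu≡)) (cong (lookup α) (inverseˡ σ)))

  generator⇒corner : ∀ {a} → a ∈ headSet j α σ → ∃[ z ] Corner i c z × a ≡ relocate p z
  generator⇒corner (here refl) = _ , spineTop , spine-generator≡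
  generator⇒corner (there a∈) with ∈-map⁻ tooth-generator a∈
  ... | u , _ , refl =
    _ , toothTop (punchOut p≢σu) , tooth-generator≡ u _ (sym (FP.punchIn-punchOut p≢σu))
    where
    p≢σu : p ≢ σ ⟨$⟩ʳ F.suc u
    p≢σu eq with trans (sym (inverseˡ σ)) (trans (cong (σ ⟨$⟩ˡ_) eq) (inverseˡ σ))
    ... | ()

  corner⇒generator : ∀ {z} → Corner i c z → relocate p z ∈ headSet j α σ
  corner⇒generator spineTop = here (sym spine-generator≡)
  corner⇒generator (toothTop t) with σ ⟨$⟩ˡ punchIn p t in σ⁻¹t≡
  ... | F.zero  = ⊥-elim (FP.punchInᵢ≢i p t (trans (sym (inverseʳ σ)) (cong (σ ⟨$⟩ʳ_) σ⁻¹t≡)))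
  ... | F.suc u = there (subst (_∈ L.map tooth-generator (allFin (suc j)))
    (tooth-generator≡ u t (trans (cong (σ ⟨$⟩ʳ_) (sym σ⁻¹t≡)) (inverseʳ σ)))
    (∈-map⁺ tooth-generator (∈-allFin u)))

  below-generator⇒below-corner : ∀ y → ∃[ a ] a ∈ headSet j α σ × y ≤ᵥ a →
                                 ∃[ z ] Corner i c z × y ≤ᵥ relocate p z
  below-generator⇒below-corner y (a , a∈ , y≤a) with generator⇒corner a∈
  ... | z , corner , refl = z , corner , y≤a

  below-corner⇒below-generator : ∀ y → ∃[ z ] Corner i c z × y ≤ᵥ relocate p z →
                                 ∃[ a ] a ∈ headSet j α σ × y ≤ᵥ a
  below-corner⇒below-generator y (z , corner , y≤) = relocate p z , corner⇒generator corner , y≤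

shape⇒1≤m : ∀ j m {i} (c : Vec ℕ (suc j)) → Shape (suc j) m (i , c) → 1 ≤ m
shape⇒1≤m j m {i} c (1≤i , _ , size) = ≤-pred (subst (2 ≤_) (sym size)
  (≤-trans (+-mono-≤ 1≤i (s≤s (z≤n {j}))) (m≤m+n (i + suc j) (V.sum c))))

RelocatedComb-headstrong : ∀ j m p {i} (c : Vec ℕ (suc j)) → Shape (suc j) m (i , c) →
                           MPartition (suc (suc j)) (suc (suc j)) m (RelocatedComb p i c)
                           × Headstrong (suc j) m (RelocatedComb p i c)
RelocatedComb-headstrong j m p {suc i'} c sh@(_ , c< , size) =
  MPartition-relocate p _ (proj₁ (Comb-δ (suc j) m c sh (inj₂ F.zero) (shape⇒1≤m j m c sh))) ,
  suc-j≤m , α , Σα , α≤α₀ , σ , λ y →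
    (λ y∈ → below-corner⇒below-generator y (∈RelocatedComb⁻ c p y∈)) ,
    (λ below → let (z , corner , y≤) = below-generator⇒below-corner y below
               in ∈RelocatedComb⁺ c p c< y corner y≤)
  where
  α : Vec ℕ (suc (suc j))
  α = i' ∷ c
  σ : Permutation′ (suc (suc j))
  σ = insert F.zero p id
  open HeadSet j α σ c (λ t → cong (lookup α) (sym (inverseˡ σ {F.suc t})))
    using (below-generator⇒below-corner; below-corner⇒below-generator)
  m≡ : m ≡ i' + suc j + V.sum c
  m≡ = suc-injective size
  suc-j≤m : suc j ≤ m
  suc-j≤m = subst (suc j ≤_) (sym m≡) (≤-trans (m≤n+m (suc j) i') (m≤m+n _ (V.sum c)))
  Σα : V.sum α ≡ m ∸ suc j
  Σα = sym (trans (cong (_∸ suc j) (trans m≡ (rearrange i' (suc j) (V.sum c))))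
                  (m+n∸m≡n (suc j) (i' + V.sum c)))
    where
    rearrange : ∀ a b s → a + b + s ≡ b + (a + s)
    rearrange = solve-∀
  α≤α₀ : ∀ q → lookup α q ≤ lookup α F.zero
  α≤α₀ F.zero    = ≤-refl
  α≤α₀ (F.suc t) = ≤-pred (c< t)

headstrong⇒RelocatedComb : ∀ j m λs →
  MPartition (suc (suc j)) (suc (suc j)) m λs → Headstrong (suc j) m λs →
  ∃[ ps ] Shape (suc j) m (proj₂ ps)
        × λs ≋ RelocatedComb (proj₁ ps) (proj₁ (proj₂ ps)) (proj₂ (proj₂ ps))
headstrong⇒RelocatedComb j m λs
  (_ , _ , _ , (λs! , _) , size , _) (_ , α , _ , α≤α₀ , σ , ≋headSet) =
  (p , (i , c)) , (s≤s z≤n , c< , shape-size) , ≋RelocatedComb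
  where
  c : Vec ℕ (suc j)
  c = tabulate (λ t → lookup α (σ ⟨$⟩ˡ punchIn (σ ⟨$⟩ʳ F.zero) t))
  c≡ : ∀ t → lookup c t ≡ lookup α (σ ⟨$⟩ˡ punchIn (σ ⟨$⟩ʳ F.zero) t)
  c≡ = VP.lookup∘tabulate _
  open HeadSet j α σ c c≡
  c< : ∀ t → lookup c t < i
  c< t = s≤s (subst (_≤ lookup α F.zero) (sym (c≡ t)) (α≤α₀ _))
  ≋RelocatedComb : λs ≋ RelocatedComb p i c
  ≋RelocatedComb y =
    (λ y∈ → let (z , corner , y≤) = below-generator⇒below-corner y (proj₁ (≋headSet y) y∈)
            in ∈RelocatedComb⁺ c p c< y corner y≤) ,
    (λ y∈ → proj₂ (≋headSet y) (below-corner⇒below-generator y (∈RelocatedComb⁻ c p y∈)))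
  shape-size : suc m ≡ i + suc j + V.sum c
  shape-size = proj₁ (comb-size⇔ (suc j) i c m) (begin
    length (Comb (suc j) i c)          ≡⟨ sym (LP.length-map (relocate p) (Comb (suc j) i c)) ⟩
    length (RelocatedComb p i c)       ≡⟨ sym (unique-length-≡ λs! RelocatedComb! ≋RelocatedComb) ⟩
    length λs                          ≡⟨ size ⟩
    1 + suc (suc j) + suc (suc j) + m  ∎)
    where
    open ≡-Reasoning
    RelocatedComb! : Unique (RelocatedComb p i c)
    RelocatedComb! = UP.map⁺ (relocate-injective p) (Comb-unique (suc j) i c)

map-≋⁻ : ∀ {n} {f : Point n → Point n} → (∀ {x y} → f x ≡ f y → x ≡ y) →
         ∀ {l l'} → L.map f l ≋ L.map f l' → l ≋ l'
map-≋⁻ {f = f} f-inj {l} {l'} map≋ x = transfer (proj₁ (map≋ (f x))) , transfer (proj₂ (map≋ (f x)))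
  where
  transfer : ∀ {l l'} → (f x ∈ L.map f l → f x ∈ L.map f l') → x ∈ l → x ∈ l'
  transfer {l' = l'} ⇒ x∈ with ∈-map⁻ f (⇒ (∈-map⁺ f x∈))
  ... | x' , x'∈ , fx≡fx' = subst (_∈ l') (sym (f-inj fx≡fx')) x'∈

InComb-tail≤1 : ∀ {k i} {c : Vec ℕ k} {a v} → InComb i c (a ∷ v) → ∀ r → lookup v r ≤ 1
InComb-tail≤1 (spine _)   r = subst (_≤ 1) (sym (VP.lookup-replicate r 0)) z≤n
InComb-tail≤1 (tooth t _) r = lookup-e≤1 t r

-- Only at the spine position does a relocated comb have a coordinate ≥ 2.
RelocatedComb-injective : ∀ j (p p' : Fin (suc (suc j))) {i i'} (c c' : Vec ℕ (suc j)) → 1 ≤ i →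
                          RelocatedComb p i c ≋ RelocatedComb p' i' c' →
                          (p , (i , c)) ≡ (p' , (i' , c'))
RelocatedComb-injective j p p' c c' 1≤i combs≋ with p FP.≟ p'
... | yes refl = cong (p ,_) (Comb-injective (suc j) c c' (map-≋⁻ (relocate-injective p) combs≋))
... | no  p≢p' with ∈-map⁻ (relocate p')
                       (proj₁ (combs≋ _) (∈-map⁺ (relocate p) (∈Comb⁺ (suc j) c (spine (s≤s 1≤i)))))
...   | a ∷ v , x∈ , 2e≡ with ≡⊎punchIn p' p
...     | inj₁ p≡p'       = ⊥-elim (p≢p' p≡p')
...     | inj₂ (r , refl) =
  ⊥-elim (2≰1 (subst (_≤ 1) v[r]≡2 (InComb-tail≤1 (∈Comb⁻ (suc j) c' x∈) r)))
  where
  2≰1 : ¬ 2 ≤ 1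
  2≰1 (s≤s ())
  v[r]≡2 : lookup v r ≡ 2
  v[r]≡2 = trans (sym (lookup-relocate-punchIn p' a v r))
                 (trans (cong (λ y → lookup y (punchIn p' r)) (sym 2e≡))
                        (lookup-relocate-p (punchIn p' r) 2 0ᵥ))

filter-nonempty : ∀ {X : Set} {P : X → Set} (P? : ∀ x → Dec (P x)) (l : List X) {n} →
                  length (filter P? l) ≡ suc n → ∃[ x ] x ∈ l × P x
filter-nonempty P? l eq with filter P? l in filter≡
... | y ∷ _ = y , ∈-filter⁻ P? (subst (y ∈_) (sym filter≡) (here refl))

-- In ℕ¹ the only degree-2 point is 2, and h_λ(2) = 1 puts it in λ.
MPartition₁-deg2 : ∀ m λs → MPartition 1 1 m λs → Deg2Standard 0 λs
MPartition₁-deg2 m λs (_ , _ , _ , _ , _ , _ , _ , h₂ , _) y =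
  (λ (_ , deg≡2) → here (only-2 y deg≡2)) , λ { (here refl) → 2∈ , refl }
  where
  only-2 : ∀ (y : Point 1) → deg y ≡ 2 → y ≡ 2 ∷ []
  only-2 (a ∷ []) deg≡2 = cong (_∷ []) (trans (sym (+-identityʳ a)) deg≡2)
  2∈ : (2 ∷ []) ∈ λs
  2∈ with filter-nonempty (λ x → deg x ≟ 2) λs h₂
  ... | x , x∈ , deg≡2 = subst (_∈ λs) (only-2 x deg≡2) x∈

count-δ : ∀ k m → HasCount _≋_ (DeltaSet k m) (coeffΦ k m)
count-δ zero zero    = count-∅ λ { _ ((_ , _ , () , _) , _) }
count-δ zero (suc m) = count-singleton (Comb 0 (2 + m) [])
  (Comb-δ 0 (suc m) [] (s≤s z≤n , (λ ()) , sym i+0+0≡i) (inj₁ (s≤s (s≤s z≤n))) (s≤s z≤n)) only-comb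
  where
  i+0+0≡i : ∀ {i} → i + 0 + 0 ≡ i
  i+0+0≡i = trans (+-identityʳ _) (+-identityʳ _)
  only-comb : ∀ λs → DeltaSet 0 (suc m) λs → λs ≋ Comb 0 (2 + m) []
  only-comb λs δ with δ⇒Comb 0 (suc m) λs δ
  ... | (i , []) , (_ , _ , size) , λs≋ =
    subst (λ i → λs ≋ Comb 0 i []) (sym (trans size i+0+0≡i)) λs≋
count-δ (suc j) m = count-image (count-shape j m) (λ (i , c) → Comb (suc j) i c)
  (λ (_ , c) sh → Comb-δ (suc j) m c sh (inj₂ F.zero) (shape⇒1≤m j m c sh))
  (λ (_ , c) (_ , c') _ _ → Comb-injective (suc j) c c')
  (δ⇒Comb (suc j) m)

count-headstrong : ∀ k m → HasCount _≋_ (λ λs → MPartition (suc k) (suc k) m λs × Headstrong k m λs)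
                                       (suc k * coeffΦ k m)
count-headstrong zero m = subst (HasCount _≋_ _) (sym (*-identityˡ _))
  (count-⇔ (λ _ δ → proj₁ δ , tt) (λ λs (mp , _) → mp , MPartition₁-deg2 m λs mp) (count-δ zero m))
count-headstrong (suc j) m = count-image (count-Fin× (count-shape j m) (suc (suc j)))
  (λ (p , (i , c)) → RelocatedComb p i c)
  (λ (p , (_ , c)) sh → RelocatedComb-headstrong j m p c sh)
  (λ (p , (_ , c)) (p' , (_ , c')) (1≤i , _) _ → RelocatedComb-injective j p p' c c' 1≤i)
  (λ λs (mp , hs) → headstrong⇒RelocatedComb j m λs mp hs)

lemma5p16 : (k m : ℕ) →
    HasCount _≋_ (DeltaSet k m) (coeffΦ k m)
    × HasCount _≋_ (λ λs → MPartition (suc k) (suc k) m λs × Headstrong k m λs)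
               (suc k * coeffΦ k m)
lemma5p16 k m = count-δ k m , count-headstrong k m
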